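{- Let $b\geq 2$ be an integer. For any two distinct divisors $d_1,d_2$ of $b$ with $d_1,d_2\neq 1$, and for any integers $u_1,u_2\geq 0$, the polynomials $\Phi_{d_1}(x^{b^{u_1}})$ and $\Phi_{d_2}(x^{b^{u_2}})$ have no common (nonconstant) factor.
   Context: $\Phi_n(x)$ denotes the $n$-th cyclotomic polynomial, i.e. the minimal polynomial over $\mathbb{Q}$ of $e^{2\pi i/n}$. -}

module Defs where

open import Data.Nat as ℕ using (ℕ; zero; suc; _∸_; _≤ᵇ_)
open import Data.Nat.Divisibility using (_∣?_)
open import Data.Bool using (if_then_else_)
open import Data.List using (List; []; _∷_; _++_; map; replicate; reverse; length; filter; upTo; foldr)
open import Data.Rational using (ℚ; 0ℚ; 1ℚ; _+_; _*_; _-_; -_)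
open import Data.Product using (_×_; ∃-syntax)
open import Relation.Binary.PropositionalEquality using (_≡_; _≢_)
open import Relation.Nullary using (¬_)

-- Polynomials in ℚ[x], represented by their list of coefficients in
-- ascending order of degree (a₀ ∷ a₁ ∷ … means a₀ + a₁ x + …).
-- Trailing zeros are allowed; equality of polynomials is coefficientwise.
Poly : Set
Poly = List ℚ

coeff : Poly → ℕ → ℚ
coeff []      _       = 0ℚ
coeff (a ∷ p) zero    = a
coeff (a ∷ p) (suc n) = coeff p n

infixl 6 _+P_
infixl 7 _*P_

_+P_ : Poly → Poly → Poly
[]      +P q       = q
(a ∷ p) +P []      = a ∷ p
(a ∷ p) +P (b ∷ q) = (a + b) ∷ (p +P q)

scaleP : ℚ → Poly → Poly
scaleP a = map (a *_)

_*P_ : Poly → Poly → Poly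
[]      *P q = []
(a ∷ p) *P q = scaleP a q +P (0ℚ ∷ (p *P q))

prodP : List Poly → Poly
prodP = foldr _*P_ (1ℚ ∷ [])

xPow : ℕ → Poly
xPow m = replicate m 0ℚ ++ (1ℚ ∷ [])

xPowMinus1 : ℕ → Poly
xPowMinus1 n = ((- 1ℚ) ∷ []) +P xPow n

substPow : ℕ → Poly → Poly
substPow m []      = []
substPow m (a ∷ p) = (a ∷ []) +P (xPow m *P substPow m p)

-- Long division by a monic polynomial (quotient only).
-- Works on descending coefficient lists; the divisor is 1 ∷ T (descending).
private
  subPref : List ℚ → List ℚ → List ℚ
  subPref []      _       = []
  subPref (a ∷ F) []      = a ∷ F
  subPref (a ∷ F) (b ∷ T) = (a - b) ∷ subPref F T

  quotDesc : ℕ → List ℚ → List ℚ → List ℚ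
  quotDesc zero    _       _ = []
  quotDesc (suc k) []      T = []
  quotDesc (suc k) (c ∷ F) T =
    if length T ≤ᵇ length F
    then c ∷ quotDesc k (subPref F (map (c *_) T)) T
    else []

-- quotient of f by the monic polynomial g (exact when g ∣ f)
divMonic : Poly → Poly → Poly
divMonic f g with reverse g
... | []      = []
... | _ ∷ T   = reverse (quotDesc (length f) (reverse f) T)

properDivisors : ℕ → List ℕ
properDivisors n = filter (_∣? n) (map suc (upTo (n ∸ 1)))

-- Cyclotomic polynomials via the standard recursion
--   Φ_n = (x^n - 1) / ∏_{d ∣ n, d < n} Φ_d ,
-- computed with fuel k (any k ≥ n gives Φ_n).
cycAux : ℕ → ℕ → Poly
cycAux zero    n = []
cycAux (suc k) n = divMonic (xPowMinus1 n) (prodP (map (cycAux k) (properDivisors n)))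

Φ : ℕ → Poly
Φ n = cycAux n n

_∣P_ : Poly → Poly → Set
h ∣P f = ∃[ k ] (∀ n → coeff (h *P k) n ≡ coeff f n)

NonConstant : Poly → Set
NonConstant h = ∃[ n ] (1 ℕ.≤ n × coeff h n ≢ 0ℚ)

NoCommonFactor : Poly → Poly → Set
NoCommonFactor f g = ∀ h → NonConstant h → h ∣P f → ¬ (h ∣P g)

-- Every Φ_d divides x^d - 1, so a common factor h of Φ_d₁(x^(b^u₁)) and Φ_d₂(x^(b^u₂)) divides
-- x^(b^u₁ d₁) - 1 and x^(b^u₂ d₂) - 1. If u₁ < u₂ then b^u₁ d₁ divides b^u₂, so h divides x^(b^u₂ · 1) - 1;
-- if u₁ = u₂ = u then h divides x^(b^u g) - 1 with g = gcd(d₁, d₂). Either way g is a proper divisor of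
-- d₁ or d₂ (as d₂ ≠ 1, resp. d₁ ≠ d₂). For a proper divisor g of d, Φ_d is coprime to xᵍ - 1: writing
-- x^d - 1 = Φ_d · P with xᵍ - 1 ∣ P, the cofactor Φ_d · P / (xᵍ - 1) is 1 + xᵍ + ⋯ + x^(d - g), which is
-- the nonzero constant d/g modulo xᵍ - 1. A Bézout identity survives the substitution x ↦ x^B, so h
-- divides 1, contradicting that it is nonconstant.
--
-- These facts about Φ_n (monic, Φ_n · ∏_{d ∣ n, d < n} Φ_d = xⁿ - 1, coprime to xᵍ - 1) follow together
-- by strong induction on n from the recursion Φ_n = (xⁿ - 1) / ∏_{d ∣ n, d < n} Φ_d, since the factors
-- in the product are pairwise coprime and each divides xⁿ - 1, so that the long division is exact.

module Submission where

open import Defs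
open import Algebra.Bundles using (CommutativeRing)
open import Data.Nat as ℕ using (ℕ; zero; suc; _≤_; _<_; _⊔_; _∸_; _≤ᵇ_; z≤n; s≤s; _^_)
import Data.Nat.Properties as ℕ
open import Data.Nat.Induction using (<-rec)
open import Data.Nat.Divisibility
  using (_∣_; _∣?_; divides; ∣⇒≤; ∣-antisym; ∣-trans; 1∣_; 0∣⇒≡0; *-monoʳ-∣)
open import Data.Nat.GCD
  using (gcd; gcd-comm; gcd-GCD; gcd[m,n]∣m; gcd[m,n]∣n; gcd[m,n]≢0; c*gcd[m,n]≡gcd[cm,cn]; module Bézout)
open import Data.List using (List; []; _∷_; _++_; map; length; reverse; upTo)
open import Data.Bool using (true; false; if_then_else_; T)
open import Data.Unit using (tt)
open import Data.List.Properties using (length-map; map-cong-local; length-reverse; unfold-reverse; reverse-involutive)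
open import Data.Sum using (_⊎_; inj₁; inj₂)
open import Data.Empty using (⊥-elim)
open import Data.Maybe using (Maybe; just; nothing)
open import Relation.Nullary using (¬_; yes; no)
open import Relation.Binary using (Tri; tri<; tri≈; tri>)
open import Data.Product using (_,_; _×_; ∃; ∃₂; proj₁; proj₂)
open import Function using (_∘_; id)
open import Data.List.Membership.Propositional using (_∈_)
open import Data.List.Relation.Unary.All as All using (All; []; _∷_)
import Data.List.Relation.Unary.All.Properties as All
open import Data.List.Relation.Unary.Any using (here; there)
open import Data.List.Relation.Unary.AllPairs using (AllPairs; []; _∷_)
import Data.List.Relation.Unary.AllPairs.Properties as AllPairs
open import Data.List.Membership.Propositional.Properties
  using (∈-filter⁻; ∈-filter⁺; ∈-map⁻; ∈-map⁺; ∈-upTo⁻; ∈-upTo⁺)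
import Relation.Binary.Reasoning.Setoid as SetoidReasoning
open import Data.Rational as ℚ using (ℚ; 0ℚ; 1ℚ)
import Data.Rational.Properties as ℚ
open import Algebra.Properties.Monoid.Mult ℚ.+-0-monoid using () renaming (_×_ to _×ℚ_)
open import Relation.Binary.PropositionalEquality
  using (_≡_; _≢_; refl; sym; trans; cong; cong₂; subst; module ≡-Reasoning)
open import Tactic.RingSolver using (solve-∀)
open import Tactic.RingSolver.Core.AlmostCommutativeRing using (AlmostCommutativeRing; fromCommutativeRing)
open import Level using (0ℓ)

-- The ring ℚ[x]

ℚ-solver : AlmostCommutativeRing 0ℓ 0ℓ
ℚ-solver = fromCommutativeRing ℚ.+-*-commutativeRing (λ _ → nothing)

infix 4 _≈_
record _≈_ (p q : Poly) : Set where
  constructor mk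
  field at : ∀ n → coeff p n ≡ coeff q n
open _≈_

≈-refl : ∀ {p} → p ≈ p
≈-refl = mk λ _ → refl

≈-reflexive : ∀ {p q} → p ≡ q → p ≈ q
≈-reflexive refl = ≈-refl

≈-sym : ∀ {p q} → p ≈ q → q ≈ p
≈-sym p≈q = mk λ n → sym (at p≈q n)

≈-trans : ∀ {p q r} → p ≈ q → q ≈ r → p ≈ r
≈-trans p≈q q≈r = mk λ n → trans (at p≈q n) (at q≈r n)

∷-cong : ∀ {a b p q} → a ≡ b → p ≈ q → a ∷ p ≈ b ∷ q
∷-cong a≡b p≈q = mk λ { zero → a≡b ; (suc n) → at p≈q n }

tail-cong : ∀ {a b p q} → a ∷ p ≈ b ∷ q → p ≈ q
tail-cong e = mk λ n → at e (suc n)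

1P : Poly
1P = 1ℚ ∷ []

constP : ℚ → Poly
constP a = a ∷ []

negP : Poly → Poly
negP = map (λ a → ℚ.- a)

0∷[]≈[] : 0ℚ ∷ [] ≈ []
0∷[]≈[] = mk λ { zero → refl ; (suc n) → refl }

coeff-+P : ∀ p q n → coeff (p +P q) n ≡ coeff p n ℚ.+ coeff q n
coeff-+P []      q       n       = sym (ℚ.+-identityˡ _)
coeff-+P (a ∷ p) []      n       = sym (ℚ.+-identityʳ _)
coeff-+P (a ∷ p) (b ∷ q) zero    = refl
coeff-+P (a ∷ p) (b ∷ q) (suc n) = coeff-+P p q n

coeff-scaleP : ∀ a q n → coeff (scaleP a q) n ≡ a ℚ.* coeff q n
coeff-scaleP a []      n       = sym (ℚ.*-zeroʳ a)
coeff-scaleP a (b ∷ q) zero    = refl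
coeff-scaleP a (b ∷ q) (suc n) = coeff-scaleP a q n

coeff-negP : ∀ q n → coeff (negP q) n ≡ ℚ.- coeff q n
coeff-negP []      n       = refl
coeff-negP (b ∷ q) zero    = refl
coeff-negP (b ∷ q) (suc n) = coeff-negP q n

coeff-*P : ∀ a p q n → coeff ((a ∷ p) *P q) n ≡ a ℚ.* coeff q n ℚ.+ coeff (0ℚ ∷ (p *P q)) n
coeff-*P a p q n = trans (coeff-+P (scaleP a q) _ n) (cong (ℚ._+ _) (coeff-scaleP a q n))

+P-cong : ∀ {p p′ q q′} → p ≈ p′ → q ≈ q′ → p +P q ≈ p′ +P q′
+P-cong {p} {p′} {q} {q′} e f = mk λ n →
  trans (coeff-+P p q n) (trans (cong₂ ℚ._+_ (at e n) (at f n)) (sym (coeff-+P p′ q′ n)))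

negP-cong : ∀ {q q′} → q ≈ q′ → negP q ≈ negP q′
negP-cong {q} {q′} e = mk λ n →
  trans (coeff-negP q n) (trans (cong (λ a → ℚ.- a) (at e n)) (sym (coeff-negP q′ n)))

+P-assoc : ∀ p q r → (p +P q) +P r ≈ p +P (q +P r)
+P-assoc p q r = mk λ n →
  trans (coeff-+P (p +P q) r n) (trans (cong (ℚ._+ coeff r n) (coeff-+P p q n))
  (trans (ℚ.+-assoc (coeff p n) (coeff q n) (coeff r n))
  (sym (trans (coeff-+P p (q +P r) n) (cong (coeff p n ℚ.+_) (coeff-+P q r n))))))

+P-comm : ∀ p q → p +P q ≈ q +P p
+P-comm p q = mk λ n →
  trans (coeff-+P p q n) (trans (ℚ.+-comm (coeff p n) (coeff q n)) (sym (coeff-+P q p n)))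

+P-identityʳ : ∀ p → p +P [] ≈ p
+P-identityʳ p = mk λ n → trans (coeff-+P p [] n) (ℚ.+-identityʳ (coeff p n))

negP-inverseˡ : ∀ p → negP p +P p ≈ []
negP-inverseˡ p = mk λ n →
  trans (coeff-+P (negP p) p n) (trans (cong (ℚ._+ coeff p n) (coeff-negP p n)) (ℚ.+-inverseˡ (coeff p n)))

negP-inverseʳ : ∀ p → p +P negP p ≈ []
negP-inverseʳ p = ≈-trans (+P-comm p (negP p)) (negP-inverseˡ p)

0∷-+P : ∀ s t → 0ℚ ∷ (s +P t) ≈ (0ℚ ∷ s) +P (0ℚ ∷ t)
0∷-+P s t = ∷-cong (sym (ℚ.+-identityˡ 0ℚ)) ≈-refl

≈[]⇒*P≈[] : ∀ p q → p ≈ [] → p *P q ≈ []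
≈[]⇒*P≈[] []      q e = ≈-refl
≈[]⇒*P≈[] (a ∷ p) q e = mk λ n → trans (coeff-*P a p q n) (trans (cong₂ ℚ._+_
  (trans (cong (ℚ._* coeff q n) (at e 0)) (ℚ.*-zeroˡ (coeff q n)))
  (at (≈-trans (∷-cong refl (≈[]⇒*P≈[] p q (mk λ k → at e (suc k)))) 0∷[]≈[]) n)) (ℚ.+-identityˡ 0ℚ))

*P-congʳ : ∀ {p p′} q → p ≈ p′ → p *P q ≈ p′ *P q
*P-congʳ {[]}    {p′}     q e = ≈-sym (≈[]⇒*P≈[] p′ q (≈-sym e))
*P-congʳ {a ∷ p} {[]}     q e = ≈[]⇒*P≈[] (a ∷ p) q e
*P-congʳ {a ∷ p} {a′ ∷ p′} q e = mk λ n → trans (coeff-*P a p q n) (trans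
  (cong₂ ℚ._+_ (cong (ℚ._* coeff q n) (at e 0)) (at (∷-cong refl (*P-congʳ q (tail-cong e))) n))
  (sym (coeff-*P a′ p′ q n)))

*P-congˡ : ∀ p {q q′} → q ≈ q′ → p *P q ≈ p *P q′
*P-congˡ []      e = ≈-refl
*P-congˡ (a ∷ p) {q} {q′} e = mk λ n → trans (coeff-*P a p q n) (trans
  (cong₂ ℚ._+_ (cong (a ℚ.*_) (at e n)) (at (∷-cong refl (*P-congˡ p e)) n))
  (sym (coeff-*P a p q′ n)))

*P-cong : ∀ {p p′ q q′} → p ≈ p′ → q ≈ q′ → p *P q ≈ p′ *P q′
*P-cong {p′ = p′} {q} e f = ≈-trans (*P-congʳ q e) (*P-congˡ p′ f)

*P-zeroʳ : ∀ p → p *P [] ≈ []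
*P-zeroʳ []      = ≈-refl
*P-zeroʳ (a ∷ p) = mk λ n → trans (coeff-*P a p [] n)
  (trans (cong₂ ℚ._+_ (ℚ.*-zeroʳ a) (at (≈-trans (∷-cong refl (*P-zeroʳ p)) 0∷[]≈[]) n))
         (ℚ.+-identityˡ _))

*P-identityˡ : ∀ p → 1P *P p ≈ p
*P-identityˡ p = mk λ n → trans (coeff-*P 1ℚ [] p n)
  (trans (cong₂ ℚ._+_ (ℚ.*-identityˡ (coeff p n)) (at 0∷[]≈[] n)) (ℚ.+-identityʳ (coeff p n)))

*P-distribˡ-+P : ∀ p q r → p *P (q +P r) ≈ p *P q +P p *P r
*P-distribˡ-+P []      q r = ≈-refl
*P-distribˡ-+P (a ∷ p) q r = mk λ n → begin
  coeff ((a ∷ p) *P (q +P r)) n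
    ≡⟨ coeff-*P a p (q +P r) n ⟩
  a ℚ.* coeff (q +P r) n ℚ.+ coeff (0ℚ ∷ (p *P (q +P r))) n
    ≡⟨ cong₂ ℚ._+_ (cong (a ℚ.*_) (coeff-+P q r n))
                   (trans (at (≈-trans (∷-cong refl (*P-distribˡ-+P p q r)) (0∷-+P (p *P q) (p *P r))) n)
                          (coeff-+P (0ℚ ∷ (p *P q)) (0ℚ ∷ (p *P r)) n)) ⟩
  a ℚ.* (coeff q n ℚ.+ coeff r n) ℚ.+ (coeff (0ℚ ∷ (p *P q)) n ℚ.+ coeff (0ℚ ∷ (p *P r)) n)
    ≡⟨ distrib-interchange a _ _ _ _ ⟩
  (a ℚ.* coeff q n ℚ.+ coeff (0ℚ ∷ (p *P q)) n) ℚ.+ (a ℚ.* coeff r n ℚ.+ coeff (0ℚ ∷ (p *P r)) n)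
    ≡⟨ sym (cong₂ ℚ._+_ (coeff-*P a p q n) (coeff-*P a p r n)) ⟩
  coeff ((a ∷ p) *P q) n ℚ.+ coeff ((a ∷ p) *P r) n
    ≡⟨ sym (coeff-+P ((a ∷ p) *P q) ((a ∷ p) *P r) n) ⟩
  coeff ((a ∷ p) *P q +P (a ∷ p) *P r) n ∎
  where
  open ≡-Reasoning
  distrib-interchange : ∀ a x y u v →
    a ℚ.* (x ℚ.+ y) ℚ.+ (u ℚ.+ v) ≡ (a ℚ.* x ℚ.+ u) ℚ.+ (a ℚ.* y ℚ.+ v)
  distrib-interchange = solve-∀ ℚ-solver

0∷-*P : ∀ p q → (0ℚ ∷ p) *P q ≈ 0ℚ ∷ (p *P q)
0∷-*P p q = mk λ n → trans (coeff-*P 0ℚ p q n)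
  (trans (cong (ℚ._+ coeff (0ℚ ∷ (p *P q)) n) (ℚ.*-zeroˡ (coeff q n))) (ℚ.+-identityˡ _))

*P-0∷ : ∀ p q → p *P (0ℚ ∷ q) ≈ 0ℚ ∷ (p *P q)
*P-0∷ []      q = ≈-sym 0∷[]≈[]
*P-0∷ (a ∷ p) q = mk λ
  { zero    → trans (coeff-*P a p (0ℚ ∷ q) 0) (trans (ℚ.+-identityʳ _) (ℚ.*-zeroʳ a))
  ; (suc n) → trans (coeff-*P a p (0ℚ ∷ q) (suc n))
                    (trans (cong (a ℚ.* coeff q n ℚ.+_) (at (*P-0∷ p q) n)) (sym (coeff-*P a p q n))) }

*P-constP : ∀ p b → p *P constP b ≈ scaleP b p
*P-constP []      b = ≈-refl
*P-constP (a ∷ p) b = mk λ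
  { zero    → trans (coeff-*P a p (b ∷ []) 0) (trans (ℚ.+-identityʳ _) (ℚ.*-comm a b))
  ; (suc n) → trans (coeff-*P a p (b ∷ []) (suc n))
                    (trans (cong₂ ℚ._+_ (ℚ.*-zeroʳ a) (at (*P-constP p b) n)) (ℚ.+-identityˡ _)) }

∷≈constP+0∷ : ∀ a p → a ∷ p ≈ constP a +P (0ℚ ∷ p)
∷≈constP+0∷ a p = ∷-cong (sym (ℚ.+-identityʳ a)) ≈-refl

*P-comm : ∀ p q → p *P q ≈ q *P p
*P-comm []      q = ≈-sym (*P-zeroʳ q)
*P-comm (a ∷ p) q = ≈-sym (≈-trans (*P-congˡ q (∷≈constP+0∷ a p))
  (≈-trans (*P-distribˡ-+P q (constP a) (0ℚ ∷ p))
  (+P-cong (*P-constP q a) (≈-trans (*P-0∷ q p) (∷-cong refl (*P-comm q p))))))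

*P-distribʳ-+P : ∀ p q r → (q +P r) *P p ≈ q *P p +P r *P p
*P-distribʳ-+P p q r = ≈-trans (*P-comm (q +P r) p)
  (≈-trans (*P-distribˡ-+P p q r) (+P-cong (*P-comm p q) (*P-comm p r)))

scaleP-*P : ∀ a q r → scaleP a q *P r ≈ scaleP a (q *P r)
scaleP-*P a []      r = ≈-refl
scaleP-*P a (b ∷ q) r = mk λ n → trans (coeff-*P (a ℚ.* b) (scaleP a q) r n) (trans
  (cong₂ ℚ._+_ (ℚ.*-assoc a b _) (at (∷-cong refl (scaleP-*P a q r)) n))
  (sym (trans (coeff-scaleP a ((b ∷ q) *P r) n) (trans (cong (a ℚ.*_) (coeff-*P b q r n))
       (trans (ℚ.*-distribˡ-+ a _ _) (cong (a ℚ.* (b ℚ.* coeff r n) ℚ.+_) (scale-0∷ n)))))))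
  where
  scale-0∷ : ∀ n → a ℚ.* coeff (0ℚ ∷ (q *P r)) n ≡ coeff (0ℚ ∷ scaleP a (q *P r)) n
  scale-0∷ zero    = ℚ.*-zeroʳ a
  scale-0∷ (suc n) = sym (coeff-scaleP a (q *P r) n)

*P-assoc : ∀ p q r → (p *P q) *P r ≈ p *P (q *P r)
*P-assoc []      q r = ≈-refl
*P-assoc (a ∷ p) q r = ≈-trans (*P-distribʳ-+P r (scaleP a q) (0ℚ ∷ (p *P q)))
  (+P-cong (scaleP-*P a q r) (≈-trans (0∷-*P (p *P q) r) (∷-cong refl (*P-assoc p q r))))

ℚ[x] : CommutativeRing 0ℓ 0ℓ
ℚ[x] = record
  { Carrier = Poly ; _≈_ = _≈_ ; _+_ = _+P_ ; _*_ = _*P_ ; -_ = negP ; 0# = [] ; 1# = 1P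
  ; isCommutativeRing = record
    { isRing = record
      { +-isAbelianGroup = record
        { isGroup = record
          { isMonoid = record
            { isSemigroup = record
              { isMagma = record
                { isEquivalence = record { refl = ≈-refl ; sym = ≈-sym ; trans = ≈-trans }
                ; ∙-cong = +P-cong }
              ; assoc = +P-assoc }
            ; identity = (λ _ → ≈-refl) , +P-identityʳ }
          ; inverse = negP-inverseˡ , negP-inverseʳ
          ; ⁻¹-cong = negP-cong }
        ; comm = +P-comm }
      ; *-cong = *P-cong
      ; *-assoc = *P-assoc
      ; *-identity = *P-identityˡ , (λ p → ≈-trans (*P-comm p 1P) (*P-identityˡ p))
      ; distrib = *P-distribˡ-+P , *P-distribʳ-+P }
    ; *-comm = *P-comm } }

-- The ring solver compares normal forms syntactically; this zero test lets it discard
-- coefficients such as 0ℚ ∷ [], which are ≈ [] but not ≡ [].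
[]≈? : ∀ p → Maybe ([] ≈ p)
[]≈? []      = just ≈-refl
[]≈? (a ∷ p) with a ℚ.≟ 0ℚ | []≈? p
... | yes a≡0 | just []≈p = just (mk λ { zero → sym a≡0 ; (suc n) → at []≈p n })
... | _       | _         = nothing

ℚ[x]-solver : AlmostCommutativeRing 0ℓ 0ℓ
ℚ[x]-solver = fromCommutativeRing ℚ[x] []≈?

open import Algebra.Properties.Semiring.Divisibility (CommutativeRing.semiring ℚ[x])
  using (_,_; ∣ʳ-trans; ∣ʳ-respʳ-≈; ∣ʳ-respˡ-≈; x∣ʳy⇒x∣ʳzy)
  renaming (_∣_ to _∣ₚ_)

-- Divisibility and coprimality

Coprime : Poly → Poly → Set
Coprime a b = ∃₂ λ r s → r *P a +P s *P b ≈ 1P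

Coprime-sym : ∀ {a b} → Coprime a b → Coprime b a
Coprime-sym {a} {b} (r , s , e) = s , r , ≈-trans (+P-comm (s *P b) (r *P a)) e

Coprime-respʳ : ∀ {a b b′} → b ≈ b′ → Coprime a b → Coprime a b′
Coprime-respʳ {a} b≈b′ (r , s , e) = r , s , ≈-trans (+P-cong (≈-refl {r *P a}) (*P-congˡ s (≈-sym b≈b′))) e

Coprime-1ʳ : ∀ a → Coprime a 1P
Coprime-1ʳ a = [] , 1P , *P-identityˡ 1P

Coprime-*ʳ : ∀ {a b c} → Coprime a b → Coprime a c → Coprime a (b *P c)
Coprime-*ʳ {a} {b} {c} (r , s , e) (r′ , s′ , e′) =
  r *P r′ *P a +P r *P s′ *P c +P s *P b *P r′ , s *P s′ ,
  ≈-trans (expand r s a b r′ s′ c) (≈-trans (*P-cong e e′) (*P-identityˡ 1P))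
  where
  expand : ∀ r s a b r′ s′ c →
    (r *P r′ *P a +P r *P s′ *P c +P s *P b *P r′) *P a +P s *P s′ *P (b *P c) ≈
    (r *P a +P s *P b) *P (r′ *P a +P s′ *P c)
  expand = solve-∀ ℚ[x]-solver

Coprime-∏ʳ : ∀ {a bs} → All (Coprime a) bs → Coprime a (prodP bs)
Coprime-∏ʳ {a} []         = Coprime-1ʳ a
Coprime-∏ʳ     (ab ∷ abs) = Coprime-*ʳ ab (Coprime-∏ʳ abs)

Coprime-absorb : ∀ {a c} u v → Coprime a (u *P a +P v *P c) → Coprime a c
Coprime-absorb {a} {c} u v (r , s , e) = r +P s *P u , s *P v , ≈-trans (regroup r s u v a c) e
  where
  regroup : ∀ r s u v a c → (r +P s *P u) *P a +P s *P v *P c ≈ r *P a +P s *P (u *P a +P v *P c)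
  regroup = solve-∀ ℚ[x]-solver

∣ₚ-linear : ∀ {h a b} r s → h ∣ₚ a → h ∣ₚ b → h ∣ₚ r *P a +P s *P b
∣ₚ-linear {h} r s (p , p*h≈a) (q , q*h≈b) =
  r *P p +P s *P q , ≈-trans (regroup r p s q h) (+P-cong (*P-congˡ r p*h≈a) (*P-congˡ s q*h≈b))
  where
  regroup : ∀ r p s q h → (r *P p +P s *P q) *P h ≈ r *P (p *P h) +P s *P (q *P h)
  regroup = solve-∀ ℚ[x]-solver

Coprime∧∣∧∣⇒∣1 : ∀ {a b h} → Coprime a b → h ∣ₚ a → h ∣ₚ b → h ∣ₚ 1P
Coprime∧∣∧∣⇒∣1 (r , s , e) h∣a h∣b = ∣ʳ-respʳ-≈ e (∣ₚ-linear r s h∣a h∣b)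

Coprime∧∣∧∣⇒*∣ : ∀ {a b F} → Coprime a b → a ∣ₚ F → b ∣ₚ F → a *P b ∣ₚ F
Coprime∧∣∧∣⇒*∣ {a} {b} {F} (r , s , e) (p , p*a≈F) (q , q*b≈F) = r *P q +P s *P p , (begin
  (r *P q +P s *P p) *P (a *P b)       ≈⟨ regroup r q s p a b ⟩
  r *P a *P (q *P b) +P s *P b *P (p *P a) ≈⟨ +P-cong (*P-congˡ (r *P a) q*b≈F) (*P-congˡ (s *P b) p*a≈F) ⟩
  r *P a *P F +P s *P b *P F           ≈⟨ ≈-sym (*P-distribʳ-+P F (r *P a) (s *P b)) ⟩
  (r *P a +P s *P b) *P F              ≈⟨ *P-congʳ F e ⟩
  1P *P F                              ≈⟨ *P-identityˡ F ⟩
  F ∎)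
  where
  open SetoidReasoning (CommutativeRing.setoid ℚ[x])
  regroup : ∀ r q s p a b → (r *P q +P s *P p) *P (a *P b) ≈ r *P a *P (q *P b) +P s *P b *P (p *P a)
  regroup = solve-∀ ℚ[x]-solver

∈⇒∣∏ : ∀ {b bs} → b ∈ bs → b ∣ₚ prodP bs
∈⇒∣∏ {b} {b ∷ bs} (here refl)   = prodP bs , *P-comm (prodP bs) b
∈⇒∣∏ {b} {c ∷ bs} (there b∈bs) = x∣ʳy⇒x∣ʳzy c (∈⇒∣∏ b∈bs)

AllPairs-Coprime∧All-∣⇒∏∣ : ∀ {bs F} → AllPairs Coprime bs → All (_∣ₚ F) bs → prodP bs ∣ₚ F
AllPairs-Coprime∧All-∣⇒∏∣ {[]}    {F} []           []           = F , ≈-trans (*P-comm F 1P) (*P-identityˡ F)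
AllPairs-Coprime∧All-∣⇒∏∣ {b ∷ bs}     (cs ∷ pairs) (b∣F ∷ bs∣F) =
  Coprime∧∣∧∣⇒*∣ (Coprime-∏ʳ cs) b∣F (AllPairs-Coprime∧All-∣⇒∏∣ pairs bs∣F)

Coprime-of-constant : ∀ {a b} r s c .{{_ : ℚ.NonZero c}} → r *P a +P s *P b ≈ constP c → Coprime a b
Coprime-of-constant {a} {b} r s c e = constP c⁻¹ *P r , constP c⁻¹ *P s , (begin
  constP c⁻¹ *P r *P a +P constP c⁻¹ *P s *P b ≈⟨ factor (constP c⁻¹) r s a b ⟩
  constP c⁻¹ *P (r *P a +P s *P b)            ≈⟨ *P-congˡ (constP c⁻¹) e ⟩
  constP c⁻¹ *P constP c                      ≈⟨ ∷-cong (trans (ℚ.+-identityʳ _) (ℚ.*-inverseˡ c)) ≈-refl ⟩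
  1P ∎)
  where
  open SetoidReasoning (CommutativeRing.setoid ℚ[x])
  c⁻¹ : ℚ
  c⁻¹ = ℚ.1/ c
  factor : ∀ v r s a b → v *P r *P a +P v *P s *P b ≈ v *P (r *P a +P s *P b)
  factor = solve-∀ ℚ[x]-solver

nonNegative-×1 : ∀ k → ℚ.NonNegative (k ×ℚ 1ℚ)
nonNegative-×1 zero    = _
nonNegative-×1 (suc k) = ℚ.nonNeg+nonNeg⇒nonNeg 1ℚ (k ×ℚ 1ℚ) {{nonNegative-×1 k}}

nonZero-suc×1 : ∀ k → ℚ.NonZero (suc k ×ℚ 1ℚ)
nonZero-suc×1 k = ℚ.pos⇒nonZero (suc k ×ℚ 1ℚ) {{ℚ.pos+nonNeg⇒pos 1ℚ (k ×ℚ 1ℚ) {{nonNegative-×1 k}}}}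

-- The polynomials xⁿ - 1

xPow-+ : ∀ m n → xPow m *P xPow n ≈ xPow (m ℕ.+ n)
xPow-+ zero    n = *P-identityˡ (xPow n)
xPow-+ (suc m) n = ≈-trans (0∷-*P (xPow m) (xPow n)) (∷-cong refl (xPow-+ m n))

xPowMinus1-0 : xPowMinus1 0 ≈ []
xPowMinus1-0 = ≈-trans (∷-cong (ℚ.+-inverseˡ 1ℚ) ≈-refl) 0∷[]≈[]

geometric : ℕ → ℕ → Poly
geometric a zero    = []
geometric a (suc k) = 1P +P xPow a *P geometric a k

geometric-*-xPowMinus1 : ∀ a k → geometric a k *P xPowMinus1 a ≈ xPowMinus1 (k ℕ.* a)
geometric-*-xPowMinus1 a zero    = ≈-sym xPowMinus1-0
geometric-*-xPowMinus1 a (suc k) = begin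
  (1P +P xPow a *P geometric a k) *P xPowMinus1 a
    ≈⟨ telescope (xPow a) (geometric a k) ⟩
  xPowMinus1 a +P xPow a *P (geometric a k *P xPowMinus1 a)
    ≈⟨ +P-cong (≈-refl {xPowMinus1 a}) (*P-congˡ (xPow a) (geometric-*-xPowMinus1 a k)) ⟩
  xPowMinus1 a +P xPow a *P xPowMinus1 (k ℕ.* a)
    ≈⟨ collapse (xPow a) (xPow (k ℕ.* a)) ⟩
  negP 1P +P xPow a *P xPow (k ℕ.* a)
    ≈⟨ +P-cong (≈-refl {negP 1P}) (xPow-+ a (k ℕ.* a)) ⟩
  xPowMinus1 (suc k ℕ.* a) ∎
  where
  open SetoidReasoning (CommutativeRing.setoid ℚ[x])
  telescope : ∀ X G → (1P +P X *P G) *P (negP 1P +P X) ≈ (negP 1P +P X) +P X *P (G *P (negP 1P +P X))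
  telescope = solve-∀ ℚ[x]-solver
  collapse : ∀ X Y → (negP 1P +P X) +P X *P (negP 1P +P Y) ≈ negP 1P +P X *P Y
  collapse = solve-∀ ℚ[x]-solver

xPowMinus1-∣ : ∀ {m n} → m ∣ n → xPowMinus1 m ∣ₚ xPowMinus1 n
xPowMinus1-∣ {m} (divides k refl) = geometric m k , geometric-*-xPowMinus1 m k

-- Modulo xᵃ - 1 every term of the geometric sum is 1.
geometric-mod : ∀ a k → ∃ λ E → geometric a k ≈ constP (k ×ℚ 1ℚ) +P E *P xPowMinus1 a
geometric-mod a zero    = [] , ≈-sym (≈-trans (+P-identityʳ (0ℚ ∷ [])) 0∷[]≈[])
geometric-mod a (suc k) with geometric-mod a k
... | E , G≈ = E +P geometric a k , (begin
  1P +P xPow a *P G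
    ≈⟨ split (xPow a) G ⟩
  1P +P G +P G *P (negP 1P +P xPow a)
    ≈⟨ +P-cong (+P-cong (≈-refl {1P}) G≈) (≈-refl {G *P xPowMinus1 a}) ⟩
  1P +P (constP (k ×ℚ 1ℚ) +P E *P xPowMinus1 a) +P G *P xPowMinus1 a
    ≈⟨ regroup (constP (k ×ℚ 1ℚ)) E G (xPowMinus1 a) ⟩
  constP (suc k ×ℚ 1ℚ) +P (E +P G) *P xPowMinus1 a ∎)
  where
  open SetoidReasoning (CommutativeRing.setoid ℚ[x])
  G : Poly
  G = geometric a k
  split : ∀ X G → 1P +P X *P G ≈ 1P +P G +P G *P (negP 1P +P X)
  split = solve-∀ ℚ[x]-solver
  regroup : ∀ C E G P → 1P +P (C +P E *P P) +P G *P P ≈ (1P +P C) +P (E +P G) *P P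
  regroup = solve-∀ ℚ[x]-solver

xPowMinus1-+ : ∀ d u → xPowMinus1 (d ℕ.+ u) ≈ xPow d *P xPowMinus1 u +P xPowMinus1 d
xPowMinus1-+ d u = ≈-trans (+P-cong (≈-refl {negP 1P}) (≈-sym (xPow-+ d u))) (expand (xPow d) (xPow u))
  where
  expand : ∀ D U → negP 1P +P D *P U ≈ D *P (negP 1P +P U) +P (negP 1P +P D)
  expand = solve-∀ ℚ[x]-solver

xPowMinus1-Bézout : ∀ {d a b u v} → d ℕ.+ u ℕ.* a ≡ v ℕ.* b →
  xPowMinus1 d ≈ negP (xPow d *P geometric a u) *P xPowMinus1 a +P geometric b v *P xPowMinus1 b
xPowMinus1-Bézout {d} {a} {b} {u} {v} eq = begin
  xPowMinus1 d
    ≈⟨ isolate (xPow d) (xPowMinus1 (u ℕ.* a)) (xPowMinus1 d) ⟩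
  (xPow d *P xPowMinus1 (u ℕ.* a) +P xPowMinus1 d) +P negP (xPow d *P xPowMinus1 (u ℕ.* a))
    ≈⟨ +P-cong (≈-sym (xPowMinus1-+ d (u ℕ.* a))) (≈-refl {negP (xPow d *P xPowMinus1 (u ℕ.* a))}) ⟩
  xPowMinus1 (d ℕ.+ u ℕ.* a) +P negP (xPow d *P xPowMinus1 (u ℕ.* a))
    ≈⟨ +P-cong (≈-reflexive (cong xPowMinus1 eq))
               (negP-cong (*P-congˡ (xPow d) (≈-sym (geometric-*-xPowMinus1 a u)))) ⟩
  xPowMinus1 (v ℕ.* b) +P negP (xPow d *P (geometric a u *P xPowMinus1 a))
    ≈⟨ +P-cong (≈-sym (geometric-*-xPowMinus1 b v)) (≈-refl {negP (xPow d *P (geometric a u *P xPowMinus1 a))}) ⟩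
  geometric b v *P xPowMinus1 b +P negP (xPow d *P (geometric a u *P xPowMinus1 a))
    ≈⟨ regroup (xPow d) (geometric a u) (xPowMinus1 a) (geometric b v *P xPowMinus1 b) ⟩
  negP (xPow d *P geometric a u) *P xPowMinus1 a +P geometric b v *P xPowMinus1 b ∎
  where
  open SetoidReasoning (CommutativeRing.setoid ℚ[x])
  isolate : ∀ D U P → P ≈ (D *P U +P P) +P negP (D *P U)
  isolate = solve-∀ ℚ[x]-solver
  regroup : ∀ D G P Q → Q +P negP (D *P (G *P P)) ≈ negP (D *P G) *P P +P Q
  regroup = solve-∀ ℚ[x]-solver

xPowMinus1-gcd : ∀ m n → ∃₂ λ A C → xPowMinus1 (gcd m n) ≈ A *P xPowMinus1 m +P C *P xPowMinus1 n
xPowMinus1-gcd m n with Bézout.identity (gcd-GCD m n)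
... | Bézout.-+ u v eq = negP (xPow (gcd m n) *P geometric m u) , geometric n v ,
  xPowMinus1-Bézout {gcd m n} {m} {n} {u} {v} eq
... | Bézout.+- u v eq = geometric m u , negP (xPow (gcd m n) *P geometric n v) ,
  ≈-trans (xPowMinus1-Bézout {gcd m n} {n} {m} {v} {u} eq)
          (+P-comm (negP (xPow (gcd m n) *P geometric n v) *P xPowMinus1 n) _)

∣-xPowMinus1-gcd : ∀ {h m n} → h ∣ₚ xPowMinus1 m → h ∣ₚ xPowMinus1 n → h ∣ₚ xPowMinus1 (gcd m n)
∣-xPowMinus1-gcd {m = m} {n} h∣ h∣′ with xPowMinus1-gcd m n
... | A , C , e = ∣ʳ-respʳ-≈ (≈-sym e) (∣ₚ-linear A C h∣ h∣′)

-- Degrees and monic polynomials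

DegreeBelow : Poly → ℕ → Set
DegreeBelow p m = ∀ n → m ≤ n → coeff p n ≡ 0ℚ

DegreeBelow-length : ∀ p → DegreeBelow p (length p)
DegreeBelow-length []      n       _         = refl
DegreeBelow-length (a ∷ p) (suc n) (s≤s l≤n) = DegreeBelow-length p n l≤n

leading : ∀ p → p ≈ [] ⊎ ∃ λ j → coeff p j ≢ 0ℚ × DegreeBelow p (suc j)
leading []      = inj₁ ≈-refl
leading (a ∷ p) with leading p
... | inj₂ (j , pj≢0 , deg) = inj₂ (suc j , pj≢0 , λ { (suc n) (s≤s j<n) → deg n j<n })
... | inj₁ p≈[] with a ℚ.≟ 0ℚ
...   | yes a≡0 = inj₁ (≈-trans (∷-cong a≡0 p≈[]) 0∷[]≈[])
...   | no  a≢0 = inj₂ (0 , a≢0 , λ { (suc n) _ → at p≈[] n })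

*P-top : ∀ p q i j → DegreeBelow p (suc i) → DegreeBelow q (suc j) →
  coeff (p *P q) (i ℕ.+ j) ≡ coeff p i ℚ.* coeff q j × DegreeBelow (p *P q) (suc (i ℕ.+ j))
*P-top []      q i       j _   _   = sym (ℚ.*-zeroˡ (coeff q j)) , λ _ _ → refl
*P-top (a ∷ p) q zero    j deg degq = top , above
  where
  p≈[] : p ≈ []
  p≈[] = mk λ n → deg (suc n) (s≤s z≤n)
  rest≈0 : ∀ n → coeff (0ℚ ∷ (p *P q)) n ≡ 0ℚ
  rest≈0 n = at (≈-trans (∷-cong refl (≈[]⇒*P≈[] p q p≈[])) 0∷[]≈[]) n
  top : coeff ((a ∷ p) *P q) j ≡ a ℚ.* coeff q j
  top = trans (coeff-*P a p q j) (trans (cong (a ℚ.* coeff q j ℚ.+_) (rest≈0 j)) (ℚ.+-identityʳ _))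
  above : DegreeBelow ((a ∷ p) *P q) (suc j)
  above n j<n = trans (coeff-*P a p q n)
    (trans (cong₂ ℚ._+_ (trans (cong (a ℚ.*_) (degq n j<n)) (ℚ.*-zeroʳ a)) (rest≈0 n)) (ℚ.+-identityʳ 0ℚ))
*P-top (a ∷ p) q (suc i) j deg degq = top , above
  where
  ih : coeff (p *P q) (i ℕ.+ j) ≡ coeff p i ℚ.* coeff q j × DegreeBelow (p *P q) (suc (i ℕ.+ j))
  ih = *P-top p q i j (λ n i<n → deg (suc n) (s≤s i<n)) degq
  q-vanishes : ∀ n → i ℕ.+ j ≤ n → a ℚ.* coeff q (suc n) ≡ 0ℚ
  q-vanishes n i+j≤n =
    trans (cong (a ℚ.*_) (degq (suc n) (s≤s (ℕ.≤-trans (ℕ.m≤n+m j i) i+j≤n)))) (ℚ.*-zeroʳ a)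
  top : coeff ((a ∷ p) *P q) (suc (i ℕ.+ j)) ≡ coeff p i ℚ.* coeff q j
  top = trans (coeff-*P a p q (suc (i ℕ.+ j)))
    (trans (cong₂ ℚ._+_ (q-vanishes (i ℕ.+ j) ℕ.≤-refl) (proj₁ ih)) (ℚ.+-identityˡ _))
  above : DegreeBelow ((a ∷ p) *P q) (suc (suc (i ℕ.+ j)))
  above (suc n) (s≤s i+j<n) = trans (coeff-*P a p q (suc n))
    (trans (cong₂ ℚ._+_ (q-vanishes n (ℕ.<⇒≤ i+j<n)) (proj₂ ih n i+j<n)) (ℚ.+-identityˡ 0ℚ))

*-≢0 : ∀ {a b} → a ≢ 0ℚ → b ≢ 0ℚ → a ℚ.* b ≢ 0ℚ
*-≢0 {a} {b} a≢0 b≢0 ab≡0 = b≢0 (begin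
  b                       ≡⟨ sym (ℚ.*-identityˡ b) ⟩
  1ℚ ℚ.* b                ≡⟨ cong (ℚ._* b) (sym (ℚ.*-inverseˡ a)) ⟩
  a⁻¹ ℚ.* a ℚ.* b         ≡⟨ ℚ.*-assoc a⁻¹ a b ⟩
  a⁻¹ ℚ.* (a ℚ.* b)       ≡⟨ cong (a⁻¹ ℚ.*_) ab≡0 ⟩
  a⁻¹ ℚ.* 0ℚ              ≡⟨ ℚ.*-zeroʳ a⁻¹ ⟩
  0ℚ ∎)
  where
  open ≡-Reasoning
  instance
    a-nonZero : ℚ.NonZero a
    a-nonZero = ℚ.≢-nonZero a≢0
  a⁻¹ : ℚ
  a⁻¹ = ℚ.1/ a

1ℚ≢0ℚ : 1ℚ ≢ 0ℚ
1ℚ≢0ℚ ()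

NonConstant∤1 : ∀ {h} → NonConstant h → ¬ h ∣ₚ 1P
NonConstant∤1 {h} (n , 1≤n , hn≢0) (k , k*h≈1) with leading h | leading k
... | inj₁ h≈[] | _ = hn≢0 (at h≈[] n)
... | inj₂ _    | inj₁ k≈[] = 1ℚ≢0ℚ (at (≈-trans (≈-sym k*h≈1) (≈[]⇒*P≈[] k h k≈[])) 0)
... | inj₂ (i , hi≢0 , degh) | inj₂ (j , kj≢0 , degk) =
  *-≢0 kj≢0 hi≢0 (trans (sym (proj₁ (*P-top k h j i degk degh)))
                         (trans (at k*h≈1 (j ℕ.+ i)) (1P-vanishes j i≢0)))
  where
  i≢0 : i ≢ 0
  i≢0 refl = hn≢0 (degh n 1≤n)
  1P-vanishes : ∀ j {i} → i ≢ 0 → coeff 1P (j ℕ.+ i) ≡ 0ℚ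
  1P-vanishes zero    {zero}  i≢0 = ⊥-elim (i≢0 refl)
  1P-vanishes zero    {suc i} _   = refl
  1P-vanishes (suc j)         _   = refl

-- Monicity of the list itself (its last entry is 1), not only of the polynomial it denotes:
-- divMonic reads the leading coefficient off the end of the list.
record Monic (p : Poly) (m : ℕ) : Set where
  constructor monic
  field
    length≡ : length p ≡ suc m
    top≡1   : coeff p m ≡ 1ℚ

Monic⇒DegreeBelow : ∀ {p m} → Monic p m → DegreeBelow p (suc m)
Monic⇒DegreeBelow {p} (monic length≡ _) = subst (DegreeBelow p) length≡ (DegreeBelow-length p)

Monic∧DegreeBelow⇒≈[] : ∀ {g m} D → Monic g m → DegreeBelow (g *P D) m → D ≈ []
Monic∧DegreeBelow⇒≈[] {g} {m} D mon@(monic _ gm≡1) deg with leading D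
... | inj₁ D≈[] = D≈[]
... | inj₂ (j , Dj≢0 , degD) = ⊥-elim (Dj≢0 (begin
  coeff D j                  ≡⟨ sym (ℚ.*-identityˡ _) ⟩
  1ℚ ℚ.* coeff D j           ≡⟨ cong (ℚ._* coeff D j) (sym gm≡1) ⟩
  coeff g m ℚ.* coeff D j    ≡⟨ sym (proj₁ (*P-top g D m j (Monic⇒DegreeBelow mon) degD)) ⟩
  coeff (g *P D) (m ℕ.+ j)   ≡⟨ deg (m ℕ.+ j) (ℕ.m≤m+n m j) ⟩
  0ℚ ∎))
  where open ≡-Reasoning

*P-cancelˡ-Monic : ∀ {g m} X Y → Monic g m → g *P X ≈ g *P Y → X ≈ Y
*P-cancelˡ-Monic {g} X Y mon gX≈gY = ≈-trans (split X Y) (+P-cong X-Y≈[] (≈-refl {Y}))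
  where
  split : ∀ X Y → X ≈ (X +P negP Y) +P Y
  split = solve-∀ ℚ[x]-solver
  distrib : ∀ g X Y → g *P (X +P negP Y) ≈ g *P X +P negP (g *P Y)
  distrib = solve-∀ ℚ[x]-solver
  g[X-Y]≈[] : g *P (X +P negP Y) ≈ []
  g[X-Y]≈[] = ≈-trans (distrib g X Y) (≈-trans (+P-cong gX≈gY ≈-refl) (negP-inverseʳ (g *P Y)))
  X-Y≈[] : X +P negP Y ≈ []
  X-Y≈[] = Monic∧DegreeBelow⇒≈[] (X +P negP Y) mon (λ n _ → at g[X-Y]≈[] n)

length-+P : ∀ p q → length (p +P q) ≡ length p ⊔ length q
length-+P []      q       = refl
length-+P (a ∷ p) []      = sym (ℕ.⊔-identityʳ (suc (length p)))
length-+P (a ∷ p) (b ∷ q) = cong suc (length-+P p q)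

length-*P : ∀ a p q {j} → length q ≡ suc j → length ((a ∷ p) *P q) ≡ suc (length p ℕ.+ j)
length-*P a []      q {j} len-q = begin
  length (scaleP a q +P (0ℚ ∷ []))        ≡⟨ length-+P (scaleP a q) (0ℚ ∷ []) ⟩
  length (scaleP a q) ⊔ 1                 ≡⟨ cong (_⊔ 1) (trans (length-map _ q) len-q) ⟩
  suc (j ⊔ 0)                             ≡⟨ cong suc (ℕ.⊔-identityʳ j) ⟩
  suc j ∎
  where open ≡-Reasoning
length-*P a (b ∷ p) q {j} len-q = begin
  length (scaleP a q +P (0ℚ ∷ ((b ∷ p) *P q)))  ≡⟨ length-+P (scaleP a q) (0ℚ ∷ ((b ∷ p) *P q)) ⟩
  length (scaleP a q) ⊔ suc (length ((b ∷ p) *P q))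
    ≡⟨ cong₂ _⊔_ (trans (length-map _ q) len-q) (cong suc (length-*P b p q len-q)) ⟩
  suc j ⊔ suc (suc (length p ℕ.+ j))
    ≡⟨ ℕ.m≤n⇒m⊔n≡n (s≤s (ℕ.≤-trans (ℕ.m≤n+m j (length p)) (ℕ.n≤1+n _))) ⟩
  suc (suc (length p ℕ.+ j)) ∎
  where open ≡-Reasoning

Monic-*P : ∀ {p q m n} → Monic p m → Monic q n → Monic (p *P q) (m ℕ.+ n)
Monic-*P {[]}    {q} {m} {n} (monic () _) _
Monic-*P {a ∷ p} {q} {m} {n} mon-p@(monic len-p pm≡1) mon-q@(monic len-q qn≡1) = monic
  (trans (length-*P a p q len-q) (cong (λ l → suc (l ℕ.+ n)) (ℕ.suc-injective len-p)))
  (trans (proj₁ (*P-top (a ∷ p) q m n (Monic⇒DegreeBelow mon-p) (Monic⇒DegreeBelow mon-q)))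
        (trans (cong₂ ℚ._*_ pm≡1 qn≡1) (ℚ.*-identityˡ 1ℚ)))

Monic-prodP : ∀ {ps} → All (∃ ∘ Monic) ps → ∃ (Monic (prodP ps))
Monic-prodP []                           = 0 , monic refl refl
Monic-prodP ((m , mon) ∷ mons) with Monic-prodP mons
... | n , mon′ = m ℕ.+ n , Monic-*P mon mon′

length-xPow : ∀ m → length (xPow m) ≡ suc m
length-xPow zero    = refl
length-xPow (suc m) = cong suc (length-xPow m)

coeff-xPow : ∀ m → coeff (xPow m) m ≡ 1ℚ
coeff-xPow zero    = refl
coeff-xPow (suc m) = coeff-xPow m

Monic-xPowMinus1 : ∀ n → Monic (xPowMinus1 (suc n)) (suc n)
Monic-xPowMinus1 n = monic
  (trans (length-+P (ℚ.- 1ℚ ∷ []) (xPow (suc n))) (cong (1 ⊔_) (length-xPow (suc n))))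
  (trans (coeff-+P (ℚ.- 1ℚ ∷ []) (xPow (suc n)) (suc n)) (trans (ℚ.+-identityˡ _) (coeff-xPow n)))

-- Long division by a monic polynomial

-- A copy of divMonic and of its helpers, which Defs keeps private; divMonic≡divMonic′ identifies the two.
subtractMultiple : ℚ → List ℚ → List ℚ → List ℚ
subtractMultiple c []      _       = []
subtractMultiple c (a ∷ F) []      = a ∷ F
subtractMultiple c (a ∷ F) (b ∷ T) = (a ℚ.- c ℚ.* b) ∷ subtractMultiple c F T

quotientDesc : ℕ → List ℚ → List ℚ → List ℚ
quotientDesc zero    _       _ = []
quotientDesc (suc k) []      T = []
quotientDesc (suc k) (c ∷ F) T =
  if length T ≤ᵇ length F then c ∷ quotientDesc k (subtractMultiple c F T) T else []

private
  quotientDesc-unique :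
    {quot : ℕ → List ℚ → List ℚ → List ℚ} {sub : ℚ → List ℚ → List ℚ → List ℚ} →
    (∀ c T → sub c [] T ≡ []) → (∀ c a F → sub c (a ∷ F) [] ≡ a ∷ F) →
    (∀ c a F b T → sub c (a ∷ F) (b ∷ T) ≡ (a ℚ.- c ℚ.* b) ∷ sub c F T) →
    (∀ F T → quot zero F T ≡ []) → (∀ k T → quot (suc k) [] T ≡ []) →
    (∀ k c F T → quot (suc k) (c ∷ F) T ≡
       (if length T ≤ᵇ length F then c ∷ quot k (sub c F T) T else [])) →
    ∀ k F T → quot k F T ≡ quotientDesc k F T
  quotientDesc-unique {quot} {sub} s₁ s₂ s₃ q₁ q₂ q₃ = go
    where
    sub≡ : ∀ c F T → sub c F T ≡ subtractMultiple c F T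
    sub≡ c []      T       = s₁ c T
    sub≡ c (a ∷ F) []      = s₂ c a F
    sub≡ c (a ∷ F) (b ∷ T) = trans (s₃ c a F b T) (cong ((a ℚ.- c ℚ.* b) ∷_) (sub≡ c F T))
    go : ∀ k F T → quot k F T ≡ quotientDesc k F T
    go zero    F       T = q₁ F T
    go (suc k) []      T = q₂ k T
    go (suc k) (c ∷ F) T with length T ≤ᵇ length F | q₃ k c F T
    ... | true  | e = trans e (cong (c ∷_) (trans (go k (sub c F T) T)
                                                  (cong (λ F′ → quotientDesc k F′ T) (sub≡ c F T))))
    ... | false | e = e

divMonic′ : Poly → Poly → Poly
divMonic′ f g with reverse g
... | []    = []
... | _ ∷ T = reverse (quotientDesc (length f) (reverse f) T)

divMonic≡divMonic′ : ∀ f g → divMonic f g ≡ divMonic′ f g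
divMonic≡divMonic′ f g
  with quotientDesc-unique (λ _ _ → refl) (λ _ _ _ → refl) (λ _ _ _ _ _ → refl)
                           (λ _ _ → refl) (λ _ _ → refl) (λ _ _ _ _ → refl)
... | quot≡ with reverse g
... | []    = refl
... | _ ∷ T with reverse {A = ℚ}
... | rev with length f | rev f
... | k | F = cong rev (quot≡ k F T)

snoc-≈ : ∀ p c → p ++ c ∷ [] ≈ p +P constP c *P xPow (length p)
snoc-≈ []      c = ≈-sym (≈-trans (*P-comm (constP c) 1P) (*P-identityˡ (constP c)))
snoc-≈ (a ∷ p) c = ≈-trans (∷-cong (sym (ℚ.+-identityʳ a)) (snoc-≈ p c))
                           (+P-cong (≈-refl {a ∷ p}) (≈-sym (*P-0∷ (constP c) (xPow (length p)))))

coeff-snoc : ∀ p c → coeff (p ++ c ∷ []) (length p) ≡ c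
coeff-snoc []      c = refl
coeff-snoc (a ∷ p) c = coeff-snoc p c

reverse-∷ : ∀ c F → reverse (c ∷ F) ≈ reverse F +P constP c *P xPow (length F)
reverse-∷ c F = begin
  reverse (c ∷ F)                                   ≡⟨ unfold-reverse c F ⟩
  reverse F ++ c ∷ []                               ≈⟨ snoc-≈ (reverse F) c ⟩
  reverse F +P constP c *P xPow (length (reverse F))
    ≡⟨ cong (λ l → reverse F +P constP c *P xPow l) (length-reverse F) ⟩
  reverse F +P constP c *P xPow (length F) ∎
  where open SetoidReasoning (CommutativeRing.setoid ℚ[x])

length-subtractMultiple : ∀ c F U → length (subtractMultiple c F U) ≡ length F
length-subtractMultiple c []      U       = refl
length-subtractMultiple c (a ∷ F) []      = refl
length-subtractMultiple c (a ∷ F) (b ∷ U) = cong suc (length-subtractMultiple c F U)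

subtractMultiple-[]ʳ : ∀ c F → subtractMultiple c F [] ≡ F
subtractMultiple-[]ʳ c []      = refl
subtractMultiple-[]ʳ c (a ∷ F) = refl

reverse-subtractMultiple : ∀ c F U → length U ≤ length F →
  reverse (subtractMultiple c F U) ≈ reverse F +P negP (constP c *P xPow (length F ∸ length U) *P reverse U)
reverse-subtractMultiple c F       []      _ rewrite subtractMultiple-[]ʳ c F =
  ≈-sym (≈-trans (+P-cong (≈-refl {reverse F}) (negP-cong (*P-zeroʳ (constP c *P xPow (length F ∸ 0)))))
                 (+P-identityʳ (reverse F)))
reverse-subtractMultiple c (a ∷ F) (b ∷ U) (s≤s U≤F) = begin
  reverse ((a ℚ.- c ℚ.* b) ∷ subtractMultiple c F U)
    ≈⟨ reverse-∷ (a ℚ.- c ℚ.* b) (subtractMultiple c F U) ⟩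
  reverse (subtractMultiple c F U) +P constP (a ℚ.- c ℚ.* b) *P xPow (length (subtractMultiple c F U))
    ≈⟨ +P-cong (reverse-subtractMultiple c F U U≤F)
               (≈-reflexive (cong (λ l → constP (a ℚ.- c ℚ.* b) *P xPow l) (length-subtractMultiple c F U))) ⟩
  (reverse F +P negP (C *P D *P reverse U)) +P (constP a +P negP (constP (c ℚ.* b))) *P xPow (length F)
    ≈⟨ +P-cong (≈-refl {reverse F +P negP (C *P D *P reverse U)})
               (*P-cong (+P-cong (≈-refl {constP a}) (negP-cong (∷-cong (sym (ℚ.+-identityʳ (c ℚ.* b))) (≈-refl {[]}))))
                        xPow-split) ⟩
  (reverse F +P negP (C *P D *P reverse U)) +P (constP a +P negP (C *P constP b)) *P (D *P xPow (length U))
    ≈⟨ regroup (reverse F) C D (reverse U) (constP a) (constP b) (xPow (length U)) ⟩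
  (reverse F +P constP a *P (D *P xPow (length U))) +P negP (C *P D *P (reverse U +P constP b *P xPow (length U)))
    ≈⟨ +P-cong (+P-cong (≈-refl {reverse F}) (*P-congˡ (constP a) (≈-sym xPow-split)))
               (negP-cong (*P-congˡ (C *P D) (≈-sym (reverse-∷ b U)))) ⟩
  (reverse F +P constP a *P xPow (length F)) +P negP (C *P D *P reverse (b ∷ U))
    ≈⟨ +P-cong (≈-sym (reverse-∷ a F)) (≈-refl {negP (C *P D *P reverse (b ∷ U))}) ⟩
  reverse (a ∷ F) +P negP (C *P D *P reverse (b ∷ U)) ∎
  where
  open SetoidReasoning (CommutativeRing.setoid ℚ[x])
  C D : Poly
  C = constP c
  D = xPow (length F ∸ length U)
  xPow-split : xPow (length F) ≈ D *P xPow (length U)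
  xPow-split = ≈-trans (≈-reflexive (cong xPow (sym (ℕ.m∸n+n≡m U≤F))))
                       (≈-sym (xPow-+ (length F ∸ length U) (length U)))
  regroup : ∀ RF C D RU A B Y →
    (RF +P negP (C *P D *P RU)) +P (A +P negP (C *P B)) *P (D *P Y) ≈
    (RF +P A *P (D *P Y)) +P negP (C *P D *P (RU +P B *P Y))
  regroup = solve-∀ ℚ[x]-solver

≤ᵇ≡true⇒≤ : ∀ m n → (m ≤ᵇ n) ≡ true → m ≤ n
≤ᵇ≡true⇒≤ m n e = ℕ.≤ᵇ⇒≤ m n (subst T (sym e) tt)

≤ᵇ≡false⇒> : ∀ m n → (m ≤ᵇ n) ≡ false → n < m
≤ᵇ≡false⇒> m n e = ℕ.≰⇒> (λ m≤n → subst T e (ℕ.≤⇒≤ᵇ m≤n))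

length-quotientDesc : ∀ k F T → length F ≤ k → length (quotientDesc k F T) ≡ length F ∸ length T
length-quotientDesc zero    []      T _ = sym (ℕ.0∸n≡0 (length T))
length-quotientDesc (suc k) []      T _ = sym (ℕ.0∸n≡0 (length T))
length-quotientDesc (suc k) (c ∷ F) T (s≤s F≤k) with length T ≤ᵇ length F in T≤ᵇF
... | false = sym (ℕ.m≤n⇒m∸n≡0 (≤ᵇ≡false⇒> (length T) (length F) T≤ᵇF))
... | true  = begin
  suc (length (quotientDesc k (subtractMultiple c F T) T))
    ≡⟨ cong suc (length-quotientDesc k _ T (subst (_≤ k) (sym (length-subtractMultiple c F T)) F≤k)) ⟩
  suc (length (subtractMultiple c F T) ∸ length T)
    ≡⟨ cong (λ l → suc (l ∸ length T)) (length-subtractMultiple c F T) ⟩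
  suc (length F ∸ length T)
    ≡⟨ sym (ℕ.+-∸-assoc 1 (≤ᵇ≡true⇒≤ (length T) (length F) T≤ᵇF)) ⟩
  suc (length F) ∸ length T ∎
  where open ≡-Reasoning

-- Lists are read in descending order here: F stands for reverse F, and the divisor is reverse T + x^(length T).
quotientDesc-spec : ∀ {g} T → g ≈ reverse T +P xPow (length T) → ∀ k F → length F ≤ k →
  ∃ λ R → DegreeBelow R (length T) × reverse F ≈ g *P reverse (quotientDesc k F T) +P R
quotientDesc-spec {g} T g≈ zero    [] _ = [] , (λ _ _ → refl) , ≈-sym (≈-trans (+P-identityʳ (g *P [])) (*P-zeroʳ g))
quotientDesc-spec {g} T g≈ (suc k) [] _ = [] , (λ _ _ → refl) , ≈-sym (≈-trans (+P-identityʳ (g *P [])) (*P-zeroʳ g))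
quotientDesc-spec {g} T g≈ (suc k) (c ∷ F) (s≤s F≤k) with length T ≤ᵇ length F in T≤ᵇF
... | false = reverse (c ∷ F) , small , ≈-sym (+P-cong (*P-zeroʳ g) (≈-refl {reverse (c ∷ F)}))
  where
  small : DegreeBelow (reverse (c ∷ F)) (length T)
  small n T≤n = DegreeBelow-length (reverse (c ∷ F)) n
    (subst (_≤ n) (sym (length-reverse (c ∷ F))) (ℕ.≤-trans (≤ᵇ≡false⇒> (length T) (length F) T≤ᵇF) T≤n))
... | true with quotientDesc-spec T g≈ k (subtractMultiple c F T)
                  (subst (_≤ k) (sym (length-subtractMultiple c F T)) F≤k)
...   | R , small , F′≈ = R , small , (begin
  reverse (c ∷ F)
    ≈⟨ reverse-∷ c F ⟩
  reverse F +P C *P xPow (length F)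
    ≈⟨ +P-cong isolate xPow-split ⟩
  (reverse F′ +P C *P D *P reverse T) +P C *P (D *P xPow (length T))
    ≈⟨ +P-cong (+P-cong F′≈ (≈-refl {C *P D *P reverse T})) (≈-refl {C *P (D *P xPow (length T))}) ⟩
  (g *P reverse Q′ +P R +P C *P D *P reverse T) +P C *P (D *P xPow (length T))
    ≈⟨ regroup g (reverse Q′) R C D (reverse T) (xPow (length T)) ⟩
  (g *P reverse Q′ +P R) +P C *P D *P (reverse T +P xPow (length T))
    ≈⟨ +P-cong (≈-refl {g *P reverse Q′ +P R}) (*P-congˡ (C *P D) (≈-sym g≈)) ⟩
  (g *P reverse Q′ +P R) +P C *P D *P g
    ≈⟨ collect g (reverse Q′) R (C *P D) ⟩
  g *P (reverse Q′ +P C *P D) +P R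
    ≈⟨ +P-cong (*P-congˡ g (≈-sym (≈-trans (reverse-∷ c Q′)
                                           (≈-reflexive (cong (λ l → reverse Q′ +P C *P xPow l) length-Q′)))))
               (≈-refl {R}) ⟩
  g *P reverse (c ∷ Q′) +P R ∎)
  where
  open SetoidReasoning (CommutativeRing.setoid ℚ[x])
  C D F′ Q′ : Poly
  C = constP c
  D = xPow (length F ∸ length T)
  F′ = subtractMultiple c F T
  Q′ = quotientDesc k F′ T
  T≤F : length T ≤ length F
  T≤F = ≤ᵇ≡true⇒≤ (length T) (length F) T≤ᵇF
  length-Q′ : length Q′ ≡ length F ∸ length T
  length-Q′ = trans (length-quotientDesc k F′ T (subst (_≤ k) (sym (length-subtractMultiple c F T)) F≤k))
                    (cong (_∸ length T) (length-subtractMultiple c F T))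
  xPow-split : C *P xPow (length F) ≈ C *P (D *P xPow (length T))
  xPow-split = *P-congˡ C (≈-trans (≈-reflexive (cong xPow (sym (ℕ.m∸n+n≡m T≤F))))
                                   (≈-sym (xPow-+ (length F ∸ length T) (length T))))
  isolate : reverse F ≈ reverse F′ +P C *P D *P reverse T
  isolate = ≈-trans (shuffle (reverse F) (C *P D *P reverse T))
                    (+P-cong (≈-sym (reverse-subtractMultiple c F T T≤F)) (≈-refl {C *P D *P reverse T}))
    where
    shuffle : ∀ P S → P ≈ (P +P negP S) +P S
    shuffle = solve-∀ ℚ[x]-solver
  regroup : ∀ g Q R C D T X → (g *P Q +P R +P C *P D *P T) +P C *P (D *P X) ≈ (g *P Q +P R) +P C *P D *P (T +P X)
  regroup = solve-∀ ℚ[x]-solver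
  collect : ∀ g Q R E → (g *P Q +P R) +P E *P g ≈ g *P (Q +P E) +P R
  collect = solve-∀ ℚ[x]-solver

Monic⇒reverse : ∀ {g m} → Monic g m → ∃ λ T → reverse g ≡ 1ℚ ∷ T × length T ≡ m
Monic⇒reverse {g} {m} (monic length≡ top≡1) with reverse g in rev-g
... | [] = ⊥-elim (ℕ.0≢1+n (trans (sym (cong length rev-g)) (trans (length-reverse g) length≡)))
... | x ∷ T = T , cong (_∷ T) x≡1 , length-T
  where
  g≡ : g ≡ reverse T ++ x ∷ []
  g≡ = trans (sym (reverse-involutive g)) (trans (cong reverse rev-g) (unfold-reverse x T))
  length-T : length T ≡ m
  length-T = ℕ.suc-injective (trans (sym (cong length rev-g)) (trans (length-reverse g) length≡))
  x≡1 : x ≡ 1ℚ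
  x≡1 = begin
    x                                          ≡⟨ sym (coeff-snoc (reverse T) x) ⟩
    coeff (reverse T ++ x ∷ []) (length (reverse T))
      ≡⟨ cong₂ coeff (sym g≡) (trans (length-reverse T) length-T) ⟩
    coeff g m                                  ≡⟨ top≡1 ⟩
    1ℚ ∎
    where open ≡-Reasoning

reverse≡1∷⇒≈ : ∀ {g T} → reverse g ≡ 1ℚ ∷ T → g ≈ reverse T +P xPow (length T)
reverse≡1∷⇒≈ {g} {T} rev-g = begin
  g                                              ≡⟨ sym (reverse-involutive g) ⟩
  reverse (reverse g)                            ≡⟨ cong reverse rev-g ⟩
  reverse (1ℚ ∷ T)                               ≈⟨ reverse-∷ 1ℚ T ⟩
  reverse T +P 1P *P xPow (length T)             ≈⟨ +P-cong (≈-refl {reverse T}) (*P-identityˡ (xPow (length T))) ⟩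
  reverse T +P xPow (length T) ∎
  where open SetoidReasoning (CommutativeRing.setoid ℚ[x])

divMonic-unfold : ∀ f {g x T} → reverse g ≡ x ∷ T →
  divMonic f g ≡ reverse (quotientDesc (length f) (reverse f) T)
divMonic-unfold f {g} rev-g = trans (divMonic≡divMonic′ f g) (unfold′ rev-g)
  where
  unfold′ : ∀ {x T} → reverse g ≡ x ∷ T → divMonic′ f g ≡ reverse (quotientDesc (length f) (reverse f) T)
  unfold′ rev-g with reverse g
  unfold′ refl | _ ∷ T = refl

length-divMonic : ∀ f {g m} → Monic g m → length (divMonic f g) ≡ length f ∸ m
length-divMonic f {g} mon with Monic⇒reverse mon
... | T , rev-g , refl = begin
  length (divMonic f g)                                      ≡⟨ cong length (divMonic-unfold f {g} rev-g) ⟩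
  length (reverse (quotientDesc (length f) (reverse f) T))
    ≡⟨ length-reverse (quotientDesc (length f) (reverse f) T) ⟩
  length (quotientDesc (length f) (reverse f) T)
    ≡⟨ length-quotientDesc (length f) (reverse f) T (ℕ.≤-reflexive (length-reverse f)) ⟩
  length (reverse f) ∸ length T                              ≡⟨ cong (_∸ length T) (length-reverse f) ⟩
  length f ∸ length T ∎
  where open ≡-Reasoning

divMonic-spec : ∀ f {g m} → Monic g m → ∃ λ R → DegreeBelow R m × f ≈ g *P divMonic f g +P R
divMonic-spec f {g} mon with Monic⇒reverse mon
... | T , rev-g , refl
  with quotientDesc-spec T (reverse≡1∷⇒≈ {g} rev-g) (length f) (reverse f) (ℕ.≤-reflexive (length-reverse f))
...   | R , small , f≈ = R , small , (begin
  f                                                             ≡⟨ sym (reverse-involutive f) ⟩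
  reverse (reverse f)                                           ≈⟨ f≈ ⟩
  g *P reverse (quotientDesc (length f) (reverse f) T) +P R
    ≡⟨ cong (λ Q → g *P Q +P R) (sym (divMonic-unfold f {g} rev-g)) ⟩
  g *P divMonic f g +P R ∎)
  where open SetoidReasoning (CommutativeRing.setoid ℚ[x])

divMonic-exact : ∀ f {g m} → Monic g m → g ∣ₚ f → g *P divMonic f g ≈ f
divMonic-exact f {g} mon (q , q*g≈f) with divMonic-spec f mon
... | R , small , f≈ = ≈-sym (≈-trans f≈ (≈-trans (+P-cong (≈-refl {g *P Q}) R≈[]) (+P-identityʳ (g *P Q))))
  where
  Q : Poly
  Q = divMonic f g
  g[q-Q]≈R : g *P (q +P negP Q) ≈ R
  g[q-Q]≈R = ≈-trans (expand g q Q)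
    (≈-trans (+P-cong (≈-trans (*P-comm g q) (≈-trans q*g≈f f≈)) (≈-refl {negP (g *P Q)})) (cancel (g *P Q) R))
    where
    expand : ∀ g q Q → g *P (q +P negP Q) ≈ g *P q +P negP (g *P Q)
    expand = solve-∀ ℚ[x]-solver
    cancel : ∀ A R → (A +P R) +P negP A ≈ R
    cancel = solve-∀ ℚ[x]-solver
  q-Q≈[] : q +P negP Q ≈ []
  q-Q≈[] = Monic∧DegreeBelow⇒≈[] (q +P negP Q) mon (λ n m≤n → trans (at g[q-Q]≈R n) (small n m≤n))
  R≈[] : R ≈ []
  R≈[] = ≈-trans (≈-sym g[q-Q]≈R) (≈-trans (*P-congˡ g q-Q≈[]) (*P-zeroʳ g))

Monic-divMonic : ∀ {f g n m} → Monic f n → Monic g m → g ∣ₚ f → Monic (divMonic f g) (n ∸ m)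
Monic-divMonic {f} {g} {n} {m} mon-f@(monic length-f top-f) mon-g g∣f with m ℕ.≤? n
... | no m≰n = ⊥-elim (1ℚ≢0ℚ (begin
  1ℚ                          ≡⟨ sym top-f ⟩
  coeff f n                   ≡⟨ sym (at (divMonic-exact f mon-g g∣f) n) ⟩
  coeff (g *P divMonic f g) n ≡⟨ at (≈-trans (*P-congˡ g Q≈[]) (*P-zeroʳ g)) n ⟩
  0ℚ ∎))
  where
  open ≡-Reasoning
  length-Q≡0 : length (divMonic f g) ≡ 0
  length-Q≡0 = trans (length-divMonic f mon-g) (trans (cong (_∸ m) length-f) (ℕ.m≤n⇒m∸n≡0 (ℕ.≰⇒> m≰n)))
  Q≈[] : divMonic f g ≈ []
  Q≈[] = mk λ k → DegreeBelow-length (divMonic f g) k (subst (_≤ k) (sym length-Q≡0) z≤n)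
... | yes m≤n = monic length-Q (begin
  coeff Q (n ∸ m)                          ≡⟨ sym (ℚ.*-identityˡ _) ⟩
  1ℚ ℚ.* coeff Q (n ∸ m)                   ≡⟨ cong (ℚ._* coeff Q (n ∸ m)) (sym (Monic.top≡1 mon-g)) ⟩
  coeff g m ℚ.* coeff Q (n ∸ m)
    ≡⟨ sym (proj₁ (*P-top g Q m (n ∸ m) (Monic⇒DegreeBelow mon-g) degQ)) ⟩
  coeff (g *P Q) (m ℕ.+ (n ∸ m))           ≡⟨ at (divMonic-exact f mon-g g∣f) (m ℕ.+ (n ∸ m)) ⟩
  coeff f (m ℕ.+ (n ∸ m))                  ≡⟨ cong (coeff f) (ℕ.m+[n∸m]≡n m≤n) ⟩
  coeff f n                                ≡⟨ top-f ⟩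
  1ℚ ∎)
  where
  open ≡-Reasoning
  Q : Poly
  Q = divMonic f g
  length-Q : length Q ≡ suc (n ∸ m)
  length-Q = trans (length-divMonic f mon-g) (trans (cong (_∸ m) length-f) (ℕ.+-∸-assoc 1 m≤n))
  degQ : DegreeBelow Q (suc (n ∸ m))
  degQ = subst (DegreeBelow Q) length-Q (DegreeBelow-length Q)

-- The substitution x ↦ xᵐ

substPow-≈[] : ∀ m {p} → p ≈ [] → substPow m p ≈ []
substPow-≈[] m {[]}    _    = ≈-refl
substPow-≈[] m {a ∷ p} p≈[] = begin
  (a ∷ []) +P xPow m *P substPow m p
    ≈⟨ +P-cong (∷-cong (at p≈[] 0) (≈-refl {[]})) (*P-congˡ (xPow m) (substPow-≈[] m {p} (mk λ n → at p≈[] (suc n)))) ⟩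
  (0ℚ ∷ []) +P xPow m *P []          ≈⟨ +P-cong 0∷[]≈[] (*P-zeroʳ (xPow m)) ⟩
  [] ∎
  where open SetoidReasoning (CommutativeRing.setoid ℚ[x])

substPow-cong : ∀ m {p p′} → p ≈ p′ → substPow m p ≈ substPow m p′
substPow-cong m {[]}    {p′}      e = ≈-sym (substPow-≈[] m (≈-sym e))
substPow-cong m {a ∷ p} {[]}      e = substPow-≈[] m e
substPow-cong m {a ∷ p} {a′ ∷ p′} e =
  +P-cong (∷-cong (at e 0) (≈-refl {[]})) (*P-congˡ (xPow m) (substPow-cong m (tail-cong e)))

substPow-+P : ∀ m p q → substPow m (p +P q) ≈ substPow m p +P substPow m q
substPow-+P m []      q       = ≈-refl
substPow-+P m (a ∷ p) []      = ≈-sym (+P-identityʳ (substPow m (a ∷ p)))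
substPow-+P m (a ∷ p) (b ∷ q) =
  ≈-trans (+P-cong (≈-refl {constP (a ℚ.+ b)}) (*P-congˡ (xPow m) (substPow-+P m p q)))
          (interchange (constP a) (constP b) (xPow m) (substPow m p) (substPow m q))
  where
  interchange : ∀ A B X P Q → (A +P B) +P X *P (P +P Q) ≈ (A +P X *P P) +P (B +P X *P Q)
  interchange = solve-∀ ℚ[x]-solver

substPow-scaleP : ∀ m c p → substPow m (scaleP c p) ≈ constP c *P substPow m p
substPow-scaleP m c []      = ≈-sym (*P-zeroʳ (constP c))
substPow-scaleP m c (a ∷ p) = begin
  constP (c ℚ.* a) +P xPow m *P substPow m (scaleP c p)
    ≈⟨ +P-cong (∷-cong (sym (ℚ.+-identityʳ _)) (≈-refl {[]})) (*P-congˡ (xPow m) (substPow-scaleP m c p)) ⟩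
  constP c *P constP a +P xPow m *P (constP c *P substPow m p)
    ≈⟨ factor (constP c) (constP a) (xPow m) (substPow m p) ⟩
  constP c *P (constP a +P xPow m *P substPow m p) ∎
  where
  open SetoidReasoning (CommutativeRing.setoid ℚ[x])
  factor : ∀ C A X P → C *P A +P X *P (C *P P) ≈ C *P (A +P X *P P)
  factor = solve-∀ ℚ[x]-solver

substPow-0∷ : ∀ m s → substPow m (0ℚ ∷ s) ≈ xPow m *P substPow m s
substPow-0∷ m s = +P-cong 0∷[]≈[] (≈-refl {xPow m *P substPow m s})

substPow-*P : ∀ m p q → substPow m (p *P q) ≈ substPow m p *P substPow m q
substPow-*P m []      q = ≈-refl
substPow-*P m (a ∷ p) q = begin
  substPow m (scaleP a q +P (0ℚ ∷ p *P q))
    ≈⟨ substPow-+P m (scaleP a q) (0ℚ ∷ p *P q) ⟩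
  substPow m (scaleP a q) +P substPow m (0ℚ ∷ p *P q)
    ≈⟨ +P-cong (substPow-scaleP m a q)
               (≈-trans (substPow-0∷ m (p *P q)) (*P-congˡ (xPow m) (substPow-*P m p q))) ⟩
  constP a *P substPow m q +P xPow m *P (substPow m p *P substPow m q)
    ≈⟨ factor (constP a) (xPow m) (substPow m p) (substPow m q) ⟩
  (constP a +P xPow m *P substPow m p) *P substPow m q ∎
  where
  open SetoidReasoning (CommutativeRing.setoid ℚ[x])
  factor : ∀ A X P Q → A *P Q +P X *P (P *P Q) ≈ (A +P X *P P) *P Q
  factor = solve-∀ ℚ[x]-solver

substPow-constP : ∀ m c → substPow m (constP c) ≈ constP c
substPow-constP m c = +P-cong (≈-refl {constP c}) (*P-zeroʳ (xPow m))

substPow-xPow : ∀ m k → substPow m (xPow k) ≈ xPow (m ℕ.* k)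
substPow-xPow m zero    = ≈-trans (substPow-constP m 1ℚ) (≈-reflexive (cong xPow (sym (ℕ.*-zeroʳ m))))
substPow-xPow m (suc k) = begin
  substPow m (0ℚ ∷ xPow k)        ≈⟨ substPow-0∷ m (xPow k) ⟩
  xPow m *P substPow m (xPow k)   ≈⟨ *P-congˡ (xPow m) (substPow-xPow m k) ⟩
  xPow m *P xPow (m ℕ.* k)        ≈⟨ xPow-+ m (m ℕ.* k) ⟩
  xPow (m ℕ.+ m ℕ.* k)            ≡⟨ cong xPow (sym (ℕ.*-suc m k)) ⟩
  xPow (m ℕ.* suc k) ∎
  where open SetoidReasoning (CommutativeRing.setoid ℚ[x])

substPow-xPowMinus1 : ∀ m k → substPow m (xPowMinus1 k) ≈ xPowMinus1 (m ℕ.* k)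
substPow-xPowMinus1 m k = ≈-trans (substPow-+P m (constP (ℚ.- 1ℚ)) (xPow k))
  (+P-cong (substPow-constP m (ℚ.- 1ℚ)) (substPow-xPow m k))

substPow-∣ : ∀ m {a b} → a ∣ₚ b → substPow m a ∣ₚ substPow m b
substPow-∣ m {a} (q , q*a≈b) = substPow m q , ≈-trans (≈-sym (substPow-*P m q a)) (substPow-cong m q*a≈b)

substPow-Coprime : ∀ m {a b} → Coprime a b → Coprime (substPow m a) (substPow m b)
substPow-Coprime m {a} {b} (r , s , e) = substPow m r , substPow m s , (begin
  substPow m r *P substPow m a +P substPow m s *P substPow m b
    ≈⟨ ≈-sym (+P-cong (substPow-*P m r a) (substPow-*P m s b)) ⟩
  substPow m (r *P a) +P substPow m (s *P b)
    ≈⟨ ≈-sym (substPow-+P m (r *P a) (s *P b)) ⟩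
  substPow m (r *P a +P s *P b)
    ≈⟨ substPow-cong m e ⟩
  substPow m 1P
    ≈⟨ substPow-constP m 1ℚ ⟩
  1P ∎)
  where open SetoidReasoning (CommutativeRing.setoid ℚ[x])

-- Cyclotomic polynomials

∈-properDivisors⁻ : ∀ {n d} → d ∈ properDivisors n → d ∣ n × 1 ≤ d × d < n
∈-properDivisors⁻ {n} d∈ with ∈-filter⁻ (_∣? n) {xs = map suc (upTo (n ∸ 1))} d∈
... | d∈range , d∣n with ∈-map⁻ suc d∈range
...   | i , i∈ , refl = d∣n , s≤s z≤n , <pred⇒suc< n (∈-upTo⁻ i∈)
  where
  <pred⇒suc< : ∀ n {i} → i < n ∸ 1 → suc i < n
  <pred⇒suc< (suc n) i<n = s≤s i<n

∈-properDivisors⁺ : ∀ {n d} → d ∣ n → 1 ≤ d → d < n → d ∈ properDivisors n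
∈-properDivisors⁺ {suc n} {suc i} d∣n _ (s≤s i<n) =
  ∈-filter⁺ (_∣? suc n) (∈-map⁺ suc (∈-upTo⁺ i<n)) d∣n

properDivisors-distinct : ∀ n → AllPairs _≢_ (properDivisors n)
properDivisors-distinct n = AllPairs.filter⁺ (_∣? n) (AllPairs.map⁺
  (AllPairs.applyUpTo⁺₁ id (n ∸ 1) (λ i<j _ → ℕ.<⇒≢ (s≤s i<j))))

cycAux-fuel : ∀ {k k′ n} → 1 ≤ n → n ≤ k → n ≤ k′ → cycAux k n ≡ cycAux k′ n
cycAux-fuel {suc k} {suc k′} {n} _ (s≤s n≤k) (s≤s n≤k′) =
  cong (λ ds → divMonic (xPowMinus1 n) (prodP ds))
       (map-cong-local (All.tabulate λ d∈ → let (_ , 1≤d , d<n) = ∈-properDivisors⁻ {n} d∈ in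
          cycAux-fuel 1≤d (ℕ.≤-trans (ℕ.<⇒≤pred d<n) n≤k) (ℕ.≤-trans (ℕ.<⇒≤pred d<n) n≤k′)))

∏Φ : ℕ → Poly
∏Φ n = prodP (map Φ (properDivisors n))

Φ-unfold : ∀ n → 1 ≤ n → Φ n ≡ divMonic (xPowMinus1 n) (∏Φ n)
Φ-unfold (suc n) _ = cong (λ ds → divMonic (xPowMinus1 (suc n)) (prodP ds))
  (map-cong-local (All.tabulate λ d∈ → let (_ , 1≤d , d<1+n) = ∈-properDivisors⁻ {suc n} d∈ in
     cycAux-fuel 1≤d (ℕ.<⇒≤pred d<1+n) ℕ.≤-refl))

-- f · (P / (xᵍ - 1)) is the geometric sum 1 + xᵍ + ⋯ + x^(qg), whose q + 1 terms are all
-- congruent to 1 modulo xᵍ - 1.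
Coprime-xPowMinus1-cofactor : ∀ {f P g} q → 1 ≤ g →
  f *P P ≈ xPowMinus1 (suc q ℕ.* g) → xPowMinus1 g ∣ₚ P → Coprime f (xPowMinus1 g)
Coprime-xPowMinus1-cofactor {f} {P} {suc g₀} q _ fP≈ (C , C*xg≈P) =
  Coprime-of-constant C (negP E) (suc q ×ℚ 1ℚ) {{nonZero-suc×1 q}} (begin
  C *P f +P negP E *P xg       ≈⟨ rearrange C f E xg ⟩
  f *P C +P negP (E *P xg)     ≈⟨ +P-cong fC≈G (≈-refl {negP (E *P xg)}) ⟩
  G +P negP (E *P xg)          ≈⟨ +P-cong G≈ (≈-refl {negP (E *P xg)}) ⟩
  c +P E *P xg +P negP (E *P xg) ≈⟨ cancel c (E *P xg) ⟩
  c ∎)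
  where
  open SetoidReasoning (CommutativeRing.setoid ℚ[x])
  xg G c E : Poly
  xg = xPowMinus1 (suc g₀)
  G  = geometric (suc g₀) (suc q)
  c  = constP (suc q ×ℚ 1ℚ)
  E  = proj₁ (geometric-mod (suc g₀) (suc q))
  G≈ : G ≈ c +P E *P xg
  G≈ = proj₂ (geometric-mod (suc g₀) (suc q))
  fC≈G : f *P C ≈ G
  fC≈G = *P-cancelˡ-Monic (f *P C) G (Monic-xPowMinus1 g₀) (begin
    xg *P (f *P C)     ≈⟨ swap xg f C ⟩
    f *P (C *P xg)     ≈⟨ *P-congˡ f C*xg≈P ⟩
    f *P P             ≈⟨ fP≈ ⟩
    xPowMinus1 (suc q ℕ.* suc g₀) ≈⟨ ≈-sym (geometric-*-xPowMinus1 (suc g₀) (suc q)) ⟩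
    G *P xg            ≈⟨ *P-comm G xg ⟩
    xg *P G ∎)
    where
    swap : ∀ X f C → X *P (f *P C) ≈ f *P (C *P X)
    swap = solve-∀ ℚ[x]-solver
  rearrange : ∀ C f E X → C *P f +P negP E *P X ≈ f *P C +P negP (E *P X)
  rearrange = solve-∀ ℚ[x]-solver
  cancel : ∀ c Y → c +P Y +P negP Y ≈ c
  cancel = solve-∀ ℚ[x]-solver

record CyclotomicFacts (n : ℕ) : Set where
  field
    Φ-monic            : ∃ (Monic (Φ n))
    Φ*∏Φ≈xPowMinus1    : Φ n *P ∏Φ n ≈ xPowMinus1 n
    Coprime-xPowMinus1 : ∀ {g} → g ∈ properDivisors n → Coprime (Φ n) (xPowMinus1 g)
open CyclotomicFacts

Φ∣xPowMinus1 : ∀ {n} → CyclotomicFacts n → Φ n ∣ₚ xPowMinus1 n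
Φ∣xPowMinus1 {n} facts = ∏Φ n , ≈-trans (*P-comm (∏Φ n) (Φ n)) (Φ*∏Φ≈xPowMinus1 facts)

gcd-∈-properDivisors : ∀ {m n} → 1 ≤ m → gcd m n ≢ m → gcd m n ∈ properDivisors m
gcd-∈-properDivisors {m} {n} 1≤m gcd≢m = ∈-properDivisors⁺ (gcd[m,n]∣m m n)
  (ℕ.n≢0⇒n>0 (gcd[m,n]≢0 m n (inj₁ (ℕ.m<n⇒n≢0 1≤m))))
  (ℕ.≤∧≢⇒< (∣⇒≤ {{ℕ.>-nonZero 1≤m}} (gcd[m,n]∣m m n)) gcd≢m)

-- gcd(e,e′) is a proper divisor of e, and x^gcd(e,e′) - 1 lies in the ideal generated by Φ e and Φ e′.
Coprime-Φ-of-∤ : ∀ {e e′} → 1 ≤ e → CyclotomicFacts e → CyclotomicFacts e′ → ¬ e ∣ e′ →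
  Coprime (Φ e) (Φ e′)
Coprime-Φ-of-∤ {e} {e′} 1≤e facts facts′ e∤e′ with xPowMinus1-gcd e e′
... | A , C , xg≈ = Coprime-absorb (A *P ∏Φ e) (C *P ∏Φ e′)
                      (Coprime-respʳ xg≈′ (Coprime-xPowMinus1 facts (gcd-∈-properDivisors 1≤e g≢e)))
  where
  g≢e : gcd e e′ ≢ e
  g≢e g≡e = e∤e′ (subst (_∣ e′) g≡e (gcd[m,n]∣n e e′))
  xg≈′ : xPowMinus1 (gcd e e′) ≈ (A *P ∏Φ e) *P Φ e +P (C *P ∏Φ e′) *P Φ e′
  xg≈′ = ≈-trans xg≈ (≈-trans
    (+P-cong (*P-congˡ A (≈-sym (Φ*∏Φ≈xPowMinus1 facts))) (*P-congˡ C (≈-sym (Φ*∏Φ≈xPowMinus1 facts′))))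
    (regroup A (Φ e) (∏Φ e) C (Φ e′) (∏Φ e′)))
    where
    regroup : ∀ A F P C F′ P′ → A *P (F *P P) +P C *P (F′ *P P′) ≈ A *P P *P F +P C *P P′ *P F′
    regroup = solve-∀ ℚ[x]-solver

Coprime-Φ : ∀ {e e′} → 1 ≤ e → 1 ≤ e′ → CyclotomicFacts e → CyclotomicFacts e′ → e ≢ e′ →
  Coprime (Φ e) (Φ e′)
Coprime-Φ {e} {e′} 1≤e 1≤e′ facts facts′ e≢e′ with e ∣? e′ | e′ ∣? e
... | no e∤e′  | _         = Coprime-Φ-of-∤ 1≤e facts facts′ e∤e′
... | yes _    | no e′∤e   = Coprime-sym (Coprime-Φ-of-∤ 1≤e′ facts′ facts e′∤e)
... | yes e∣e′ | yes e′∣e  = ⊥-elim (e≢e′ (∣-antisym e∣e′ e′∣e))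

AllPairs-Coprime-Φ : ∀ {ds} → All (λ d → 1 ≤ d × CyclotomicFacts d) ds → AllPairs _≢_ ds →
  AllPairs Coprime (map Φ ds)
AllPairs-Coprime-Φ []                        []                = []
AllPairs-Coprime-Φ ((1≤d , facts) ∷ allFacts) (d∉ds ∷ distinct) =
  All.map⁺ (All.zipWith (λ { ((1≤d′ , facts′) , d≢d′) → Coprime-Φ 1≤d 1≤d′ facts facts′ d≢d′ })
                        (allFacts , d∉ds))
  ∷ AllPairs-Coprime-Φ allFacts distinct

FactsBelow : ℕ → Set
FactsBelow N = ∀ {d} → 1 ≤ d → d < N → CyclotomicFacts d

facts-properDivisors : ∀ {N} → FactsBelow N → All (λ d → 1 ≤ d × CyclotomicFacts d) (properDivisors N)
facts-properDivisors {N} below = All.tabulate λ d∈ →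
  let (_ , 1≤d , d<N) = ∈-properDivisors⁻ {N} d∈ in 1≤d , below 1≤d d<N

Monic-∏Φ : ∀ {N} → FactsBelow N → ∃ (Monic (∏Φ N))
Monic-∏Φ below = Monic-prodP (All.map⁺ (All.map (Φ-monic ∘ proj₂) (facts-properDivisors below)))

∏Φ∣xPowMinus1 : ∀ {N} → FactsBelow N → ∏Φ N ∣ₚ xPowMinus1 N
∏Φ∣xPowMinus1 {N} below = AllPairs-Coprime∧All-∣⇒∏∣
  (AllPairs-Coprime-Φ (facts-properDivisors below) (properDivisors-distinct N))
  (All.map⁺ (All.tabulate λ {d} d∈ → let (d∣N , 1≤d , d<N) = ∈-properDivisors⁻ {N} d∈ in
     ∣ʳ-trans (Φ∣xPowMinus1 (below 1≤d d<N)) (xPowMinus1-∣ d∣N)))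

-- xᵍ - 1 = ∏ Φ d over the divisors d of g, all of which are proper divisors of N.
xPowMinus1-∣-∏Φ : ∀ {N g} → FactsBelow N → g ∈ properDivisors N → xPowMinus1 g ∣ₚ ∏Φ N
xPowMinus1-∣-∏Φ {N} {g} below g∈ = ∣ʳ-respˡ-≈ (Φ*∏Φ≈xPowMinus1 (below 1≤g g<N))
  (AllPairs-Coprime∧All-∣⇒∏∣ (AllPairs-Coprime-Φ facts distinct)
                             (All.map⁺ (All.tabulate (∈⇒∣∏ ∘ ∈-map⁺ Φ ∘ divisor∈))))
  where
  g∣N : g ∣ N
  g∣N = proj₁ (∈-properDivisors⁻ {N} g∈)
  1≤g : 1 ≤ g
  1≤g = proj₁ (proj₂ (∈-properDivisors⁻ {N} g∈))
  g<N : g < N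
  g<N = proj₂ (proj₂ (∈-properDivisors⁻ {N} g∈))
  divisor∈ : ∀ {d} → d ∈ g ∷ properDivisors g → d ∈ properDivisors N
  divisor∈ (here refl) = g∈
  divisor∈ (there d∈) = let (d∣g , 1≤d , d<g) = ∈-properDivisors⁻ {g} d∈ in
    ∈-properDivisors⁺ (∣-trans d∣g g∣N) 1≤d (ℕ.<-trans d<g g<N)
  facts : All (λ d → 1 ≤ d × CyclotomicFacts d) (g ∷ properDivisors g)
  facts = All.tabulate λ d∈ →
    let (_ , 1≤d , d<N) = ∈-properDivisors⁻ {N} (divisor∈ d∈) in 1≤d , below 1≤d d<N
  distinct : AllPairs _≢_ (g ∷ properDivisors g)
  distinct = All.tabulate (λ d∈ g≡d → ℕ.<⇒≢ (proj₂ (proj₂ (∈-properDivisors⁻ {g} d∈))) (sym g≡d))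
           ∷ properDivisors-distinct g

cyclotomicFacts-step : ∀ {N} → 1 ≤ N → FactsBelow N → CyclotomicFacts N
cyclotomicFacts-step {suc N₀} 1≤N below = record
  { Φ-monic            = suc N₀ ∸ m , subst (λ p → Monic p (suc N₀ ∸ m)) (sym (Φ-unfold N 1≤N))
                                        (Monic-divMonic (Monic-xPowMinus1 N₀) monic-∏ ∏∣)
  ; Φ*∏Φ≈xPowMinus1    = Φ*∏Φ≈
  ; Coprime-xPowMinus1 = coprime
  }
  where
  N m : ℕ
  N = suc N₀
  m = proj₁ (Monic-∏Φ below)
  monic-∏ : Monic (∏Φ N) m
  monic-∏ = proj₂ (Monic-∏Φ below)
  ∏∣ : ∏Φ N ∣ₚ xPowMinus1 N
  ∏∣ = ∏Φ∣xPowMinus1 below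
  Φ*∏Φ≈ : Φ N *P ∏Φ N ≈ xPowMinus1 N
  Φ*∏Φ≈ = ≈-trans (≈-reflexive (cong (_*P ∏Φ N) (Φ-unfold N 1≤N)))
            (≈-trans (*P-comm (divMonic (xPowMinus1 N) (∏Φ N)) (∏Φ N))
                     (divMonic-exact (xPowMinus1 N) monic-∏ ∏∣))
  coprime : ∀ {g} → g ∈ properDivisors N → Coprime (Φ N) (xPowMinus1 g)
  coprime {g} g∈ with ∈-properDivisors⁻ {N} g∈
  ... | divides (suc q) N≡ , 1≤g , _ =
    Coprime-xPowMinus1-cofactor q 1≤g (≈-trans Φ*∏Φ≈ (≈-reflexive (cong xPowMinus1 N≡)))
                                      (xPowMinus1-∣-∏Φ below g∈)

cyclotomicFacts : ∀ n → 1 ≤ n → CyclotomicFacts n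
cyclotomicFacts = <-rec (λ n → 1 ≤ n → CyclotomicFacts n)
  λ n rec 1≤n → cyclotomicFacts-step 1≤n (λ 1≤d d<n → rec d<n 1≤d)

-- Common factors of Φ_d(x^B)

∣P⇒∣ₚ : ∀ {h f} → h ∣P f → h ∣ₚ f
∣P⇒∣ₚ {h} (k , e) = k , ≈-trans (*P-comm k h) (mk e)

substPow-Φ∣xPowMinus1 : ∀ B {d} → 1 ≤ d → substPow B (Φ d) ∣ₚ xPowMinus1 (B ℕ.* d)
substPow-Φ∣xPowMinus1 B {d} 1≤d =
  ∣ʳ-respʳ-≈ (substPow-xPowMinus1 B d) (substPow-∣ B (Φ∣xPowMinus1 (cyclotomicFacts d 1≤d)))

substPow-Φ-no-common-factor : ∀ B {d g h} → 1 ≤ d → g ∈ properDivisors d → NonConstant h →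
  h ∣ₚ substPow B (Φ d) → ¬ h ∣ₚ xPowMinus1 (B ℕ.* g)
substPow-Φ-no-common-factor B {d} {g} 1≤d g∈ nonConst h∣Φ h∣xg = NonConstant∤1 nonConst
  (Coprime∧∣∧∣⇒∣1 (substPow-Coprime B (Coprime-xPowMinus1 (cyclotomicFacts d 1≤d) g∈))
                  h∣Φ (∣ʳ-respʳ-≈ (≈-sym (substPow-xPowMinus1 B g)) h∣xg))

h∣xPowMinus1-gcd : ∀ B {d₁ d₂ h} → 1 ≤ d₁ → 1 ≤ d₂ →
  h ∣ₚ substPow B (Φ d₁) → h ∣ₚ substPow B (Φ d₂) → h ∣ₚ xPowMinus1 (B ℕ.* gcd d₁ d₂)
h∣xPowMinus1-gcd B {d₁} {d₂} {h} 1≤d₁ 1≤d₂ h∣Φ₁ h∣Φ₂ =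
  subst (λ n → h ∣ₚ xPowMinus1 n) (sym (c*gcd[m,n]≡gcd[cm,cn] B d₁ d₂))
    (∣-xPowMinus1-gcd {m = B ℕ.* d₁} {B ℕ.* d₂} (∣ʳ-trans h∣Φ₁ (substPow-Φ∣xPowMinus1 B 1≤d₁))
                                               (∣ʳ-trans h∣Φ₂ (substPow-Φ∣xPowMinus1 B 1≤d₂)))

-- A common factor of Φ_d₁(x^B) and Φ_d₂(x^B) divides x^(B gcd(d₁,d₂)) - 1,
-- and gcd(d₁,d₂) is a proper divisor of d₁ or of d₂.
no-common-factor-same-power : ∀ B {d₁ d₂ h} → 1 ≤ d₁ → 1 ≤ d₂ → d₁ ≢ d₂ → NonConstant h →
  h ∣ₚ substPow B (Φ d₁) → ¬ h ∣ₚ substPow B (Φ d₂)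
no-common-factor-same-power B {d₁} {d₂} 1≤d₁ 1≤d₂ d₁≢d₂ nonConst h∣Φ₁ h∣Φ₂ with gcd d₁ d₂ ℕ.≟ d₁
... | no  g≢d₁ = substPow-Φ-no-common-factor B 1≤d₁ (gcd-∈-properDivisors 1≤d₁ g≢d₁) nonConst h∣Φ₁
                   (h∣xPowMinus1-gcd B 1≤d₁ 1≤d₂ h∣Φ₁ h∣Φ₂)
... | yes g≡d₁ = substPow-Φ-no-common-factor B 1≤d₂ (gcd-∈-properDivisors 1≤d₂ g′≢d₂) nonConst h∣Φ₂
                   (h∣xPowMinus1-gcd B 1≤d₂ 1≤d₁ h∣Φ₂ h∣Φ₁)
  where
  g′≢d₂ : gcd d₂ d₁ ≢ d₂
  g′≢d₂ g′≡d₂ = d₁≢d₂ (trans (sym g≡d₁) (trans (gcd-comm d₁ d₂) g′≡d₂))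

^-monoʳ-∣ : ∀ b {m n} → m ≤ n → b ^ m ∣ b ^ n
^-monoʳ-∣ b {m} {n} m≤n = divides (b ^ (n ∸ m)) (begin
  b ^ n                   ≡⟨ cong (b ^_) (sym (ℕ.m+[n∸m]≡n m≤n)) ⟩
  b ^ (m ℕ.+ (n ∸ m))     ≡⟨ ℕ.^-distribˡ-+-* b m (n ∸ m) ⟩
  b ^ m ℕ.* b ^ (n ∸ m)   ≡⟨ ℕ.*-comm (b ^ m) (b ^ (n ∸ m)) ⟩
  b ^ (n ∸ m) ℕ.* b ^ m ∎)
  where open ≡-Reasoning

-- For u₁ < u₂, x^(b^u₁ d₁) - 1 divides x^(b^u₂) - 1, and 1 is a proper divisor of d₂.
no-common-factor-different-powers : ∀ b {d₁ d₂ u₁ u₂ h} → 1 ≤ d₁ → 1 ≤ d₂ → d₁ ∣ b → d₂ ≢ 1 →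
  u₁ < u₂ → NonConstant h → h ∣ₚ substPow (b ^ u₁) (Φ d₁) → ¬ h ∣ₚ substPow (b ^ u₂) (Φ d₂)
no-common-factor-different-powers b {d₁} {d₂} {u₁} {u₂} {h} 1≤d₁ 1≤d₂ d₁∣b d₂≢1 u₁<u₂ nonConst h∣Φ₁ h∣Φ₂ =
  substPow-Φ-no-common-factor (b ^ u₂) 1≤d₂ 1∈ nonConst h∣Φ₂
    (subst (λ n → h ∣ₚ xPowMinus1 n) (sym (ℕ.*-identityʳ (b ^ u₂)))
      (∣ʳ-trans (∣ʳ-trans h∣Φ₁ (substPow-Φ∣xPowMinus1 (b ^ u₁) 1≤d₁)) (xPowMinus1-∣ b^u₁d₁∣b^u₂)))
  where
  1∈ : 1 ∈ properDivisors d₂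
  1∈ = ∈-properDivisors⁺ (1∣ d₂) ℕ.≤-refl (ℕ.≤∧≢⇒< 1≤d₂ (d₂≢1 ∘ sym))
  b^u₁d₁∣b^u₂ : b ^ u₁ ℕ.* d₁ ∣ b ^ u₂
  b^u₁d₁∣b^u₂ = ∣-trans (*-monoʳ-∣ (b ^ u₁) d₁∣b)
                  (subst (_∣ b ^ u₂) (ℕ.*-comm b (b ^ u₁)) (^-monoʳ-∣ b u₁<u₂))

divisor-positive : ∀ {b d} → 1 ≤ b → d ∣ b → 1 ≤ d
divisor-positive {suc b} _ d∣b = ℕ.n≢0⇒n>0 λ { refl → ℕ.0≢1+n (sym (0∣⇒≡0 d∣b)) }

proposition2p2 : (b : ℕ) → 2 ≤ b →
    (d₁ d₂ : ℕ) → d₁ ∣ b → d₂ ∣ b → d₁ ≢ d₂ → d₁ ≢ 1 → d₂ ≢ 1 →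
    (u₁ u₂ : ℕ) →
    NoCommonFactor (substPow (b ^ u₁) (Φ d₁)) (substPow (b ^ u₂) (Φ d₂))
proposition2p2 b 2≤b d₁ d₂ d₁∣b d₂∣b d₁≢d₂ d₁≢1 d₂≢1 u₁ u₂ h nonConst h∣Φ₁ h∣Φ₂ =
  by-comparison (ℕ.<-cmp u₁ u₂) (∣P⇒∣ₚ h∣Φ₁) (∣P⇒∣ₚ h∣Φ₂)
  where
  1≤d₁ : 1 ≤ d₁
  1≤d₁ = divisor-positive (ℕ.<⇒≤ 2≤b) d₁∣b
  1≤d₂ : 1 ≤ d₂
  1≤d₂ = divisor-positive (ℕ.<⇒≤ 2≤b) d₂∣b
  by-comparison : ∀ {u₁ u₂} → Tri (u₁ < u₂) (u₁ ≡ u₂) (u₂ < u₁) →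
    h ∣ₚ substPow (b ^ u₁) (Φ d₁) → ¬ h ∣ₚ substPow (b ^ u₂) (Φ d₂)
  by-comparison (tri< u₁<u₂ _ _) = no-common-factor-different-powers b 1≤d₁ 1≤d₂ d₁∣b d₂≢1 u₁<u₂ nonConst
  by-comparison {u₁} (tri≈ _ refl _) = no-common-factor-same-power (b ^ u₁) 1≤d₁ 1≤d₂ d₁≢d₂ nonConst
  by-comparison (tri> _ _ u₂<u₁) h∣Φ₁ h∣Φ₂ =
    no-common-factor-different-powers b 1≤d₂ 1≤d₁ d₂∣b d₁≢1 u₂<u₁ nonConst h∣Φ₂ h∣Φ₁
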